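{- Let $S$ be a linearly dependent set of permutations all of whose orders are larger than one. Then: (a) $S$ is not a singleton; (b) if $|S|=2$, then both permutations in $S$ have order two; (c) if $|S|=3$ and all permutations in $S$ have the same order, then this common order is three.
   Context: $[k]=\{1,\dots,k\}$; a $k$-permutation is a bijection $\pi:[k]\to[k]$, its order is $k$. The gradient polynomial of a $k$-permutation $\pi$ is $P_\pi(\alpha,\beta)=k!\sum_{m\in[k]}\left(\frac{k-m}{1-\alpha}-\frac{m-1}{\alpha}\right)\left(\frac{k-\pi(m)}{1-\beta}-\frac{\pi(m)-1}{\beta}\right)\frac{\alpha^{m-1}(1-\alpha)^{k-m}\beta^{\pi(m)-1}(1-\beta)^{k-\pi(m)}}{(m-1)!(k-m)!(\pi(m)-1)!(k-\pi(m))!}$, a polynomial in $\alpha,\beta$. A set $S$ of permutations is linearly dependent if the gradient polynomials $P_\pi$, $\pi\in S$, are linearly dependent, i.e. there are reals $t_\pi$, $\pi\in S$, not all zero, with $\sum_{\pi\in S}t_\pi P_\pi=0$.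
   Formalization: The coefficients $t_\pi$ in the definition of linear dependence are rational rather than real. -}

module Defs where

open import Data.Nat as ℕ using (ℕ; zero; suc; _∸_; _!)
open import Data.Nat.Properties using (_!*_!≢0)
open import Data.Integer using (+_)
open import Data.Rational using (ℚ; _+_; _*_; _-_; _/_; 0ℚ; 1ℚ)
open import Data.Fin as F using (Fin; toℕ)
open import Data.Fin.Permutation using (Permutation′; _⟨$⟩ʳ_)
open import Data.Product using (_×_; Σ; ∃)
open import Relation.Nullary using (¬_)
open import Relation.Binary.PropositionalEquality using (_≡_)

ℕ→ℚ : ℕ → ℚ
ℕ→ℚ n = + n / 1

_^ℚ_ : ℚ → ℕ → ℚ
x ^ℚ zero  = 1ℚ
x ^ℚ suc n = x * (x ^ℚ n)

Σ[<] : (n : ℕ) → (Fin n → ℚ) → ℚ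
Σ[<] zero    f = 0ℚ
Σ[<] (suc n) f = f F.zero + Σ[<] n (λ i → f (F.suc i))

record Perm : Set where
  constructor perm
  field
    order : ℕ
    π     : Permutation′ order
open Perm public

-- One factor of the gradient polynomial, for position m = j+1 (j = m-1 ∈ {0..k-1}):
--   ((k-m)/(1-x) - (m-1)/x) * x^(m-1) (1-x)^(k-m) / ((m-1)! (k-m)!)
-- written division-free (the truncated exponents only occur when the
-- corresponding coefficient k-m resp. m-1 is zero).
gradFactor : (k j : ℕ) → ℚ → ℚ
gradFactor k j x =
  ( ℕ→ℚ (k ∸ suc j) * (x ^ℚ j) * ((1ℚ - x) ^ℚ (k ∸ suc j ∸ 1))
  - ℕ→ℚ j * (x ^ℚ (j ∸ 1)) * ((1ℚ - x) ^ℚ (k ∸ suc j)) )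
  * (+ 1 / (j ! ℕ.* (k ∸ suc j) !)) {{_!*_!≢0 j (k ∸ suc j)}}

gradPoly : Perm → ℚ → ℚ → ℚ
gradPoly (perm k σ) α β =
  ℕ→ℚ (k !) * Σ[<] k (λ m → gradFactor k (toℕ m) α * gradFactor k (toℕ (σ ⟨$⟩ʳ m)) β)

SamePerm : Perm → Perm → Set
SamePerm p q = order p ≡ order q
  × (∀ (i : Fin (order p)) (j : Fin (order q)) → toℕ i ≡ toℕ j →
       toℕ (π p ⟨$⟩ʳ i) ≡ toℕ (π q ⟨$⟩ʳ j))

-- A finite set S of permutations, given as an enumeration S : Fin n → Perm
-- without repetitions, is linearly dependent if some coefficients, not all
-- zero, make the combination of gradient polynomials vanish identically.
LinDep : (n : ℕ) → (Fin n → Perm) → Set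
LinDep n S = Σ (Fin n → ℚ) λ t → (∃ λ i → ¬ (t i ≡ 0ℚ))
  × (∀ α β → Σ[<] n (λ i → t i * gradPoly (S i) α β) ≡ 0ℚ)

-- Put α = N/(N+1), β = M/(M+1) and clear denominators: the gradient polynomial of a
-- permutation π of order k = D + 2 becomes k! Σ_r A_r(N) A_(π r)(M), where the factor
-- polynomials A_r(y) = w_r y^r - w_(r-1) y^(r-1), w_s = 1/(s! (D-s)!), satisfy no linear
-- relation except Σ_r A_r = 0 (Abel summation, and a polynomial vanishing on ℕ is zero).
-- Hence a relation Σ_i t_i P_(π_i) = 0 among permutations of one order makes the matrix
-- X(r,s) = Σ_i t_i [π_i r = s] of the form a(r) + b(s); all its row and column sums are
-- Σ_i t_i, so X is constant. If k exceeds the number n of permutations, some X(0,s)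
-- vanishes, so X = 0, and for n ≤ 3 distinct permutations this forces t = 0 (three
-- distinct permutations cannot all have order 2).
-- For orders ka < kb the relation is a polynomial identity in N in which the ka-term
-- carries the factor (N+1)^(kb-ka). At N = -1 it says that A_r(-1) does not depend on r,
-- but A_0(-1) = w_0 > 0 > -w_1 - w_0 = A_1(-1).

module Submission where

open import Defs
open import Data.Nat as ℕ using (ℕ; zero; suc; _∸_; _!; NonZero; _<_; _≤_; z≤n; s≤s; z<s; s<s)
import Data.Nat.Properties as ℕP
open import Data.Nat.Properties using (_!*_!≢0; _!≢0)
import Data.Integer as ℤ
import Data.Integer.Properties as ℤP
open import Data.Rational using (ℚ; _+_; _*_; _-_; -_; _/_; 0ℚ; 1ℚ; toℚᵘ; 1/_; Positive; ≢-nonZero)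
open import Data.Rational.Properties
import Data.Rational.Unnormalised as U
import Data.Rational.Unnormalised.Properties as UP
open import Data.Rational.Solver using (module +-*-Solver)
open import Algebra.Properties.Group +-0-group using () renaming (x∙y⁻¹≈ε⇒x≈y to x-y≡0⇒x≡y)
import Algebra.Properties.CommutativeMonoid.Sum +-0-commutativeMonoid as Sum
open import Data.Fin as F using (Fin; toℕ)
import Data.Fin.Properties as FP
open import Data.Fin.Permutation using (_⟨$⟩ʳ_; _⟨$⟩ˡ_; inverseˡ)
open import Data.Bool using (if_then_else_)
open import Data.List using (List; []; _∷_; length; map)
open import Data.List.Relation.Unary.All using (All; []; _∷_)
open import Data.Product using (_×_; _,_; proj₁; proj₂; ∃-syntax)
open import Data.Sum using (inj₁; inj₂)
open import Data.Empty using (⊥; ⊥-elim)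
open import Function using (_∘_)
open import Relation.Nullary using (¬_; Dec; yes; no)
open import Relation.Nullary.Decidable using (decidable-stable)
open import Relation.Binary.PropositionalEquality
open import Relation.Binary.Definitions using (Tri; tri<; tri≈; tri>)

open +-*-Solver

toℚᵘ-ℕ→ℚ : ∀ n → toℚᵘ (ℕ→ℚ n) U.≃ U.mkℚᵘ (ℤ.+ n) 0
toℚᵘ-ℕ→ℚ n = toℚᵘ-fromℚᵘ (U.mkℚᵘ (ℤ.+ n) 0)

ℕ→ℚ-+ : ∀ a b → ℕ→ℚ (a ℕ.+ b) ≡ ℕ→ℚ a + ℕ→ℚ b
ℕ→ℚ-+ a b = toℚᵘ-injective (UP.≃-trans (toℚᵘ-ℕ→ℚ (a ℕ.+ b)) (UP.≃-trans (U.*≡* eq)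
  (UP.≃-sym (UP.≃-trans (toℚᵘ-homo-+ (ℕ→ℚ a) (ℕ→ℚ b)) (UP.+-cong (toℚᵘ-ℕ→ℚ a) (toℚᵘ-ℕ→ℚ b))))))
  where
  eq : ℤ.+ (a ℕ.+ b) ℤ.* ℤ.+ 1 ≡ (ℤ.+ a ℤ.* ℤ.+ 1 ℤ.+ ℤ.+ b ℤ.* ℤ.+ 1) ℤ.* ℤ.+ 1
  eq = cong (ℤ._* ℤ.+ 1) (trans (ℤP.pos-+ a b) (sym (cong₂ ℤ._+_ (ℤP.*-identityʳ (ℤ.+ a)) (ℤP.*-identityʳ (ℤ.+ b)))))

ℕ→ℚ-* : ∀ a b → ℕ→ℚ (a ℕ.* b) ≡ ℕ→ℚ a * ℕ→ℚ b
ℕ→ℚ-* a b = toℚᵘ-injective (UP.≃-trans (toℚᵘ-ℕ→ℚ (a ℕ.* b)) (UP.≃-trans (U.*≡* eq)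
  (UP.≃-sym (UP.≃-trans (toℚᵘ-homo-* (ℕ→ℚ a) (ℕ→ℚ b)) (UP.*-cong (toℚᵘ-ℕ→ℚ a) (toℚᵘ-ℕ→ℚ b))))))
  where
  eq : ℤ.+ (a ℕ.* b) ℤ.* ℤ.+ 1 ≡ (ℤ.+ a ℤ.* ℤ.+ b) ℤ.* ℤ.+ 1
  eq = cong (ℤ._* ℤ.+ 1) (ℤP.pos-* a b)

ℕ→ℚ-inverseʳ : ∀ n .{{_ : NonZero n}} → ℕ→ℚ n * (ℤ.+ 1 / n) ≡ 1ℚ
ℕ→ℚ-inverseʳ (suc n) = toℚᵘ-injective (UP.≃-trans (toℚᵘ-homo-* (ℕ→ℚ (suc n)) (ℤ.+ 1 / suc n))
  (UP.≃-trans (UP.*-cong (toℚᵘ-ℕ→ℚ (suc n)) (toℚᵘ-fromℚᵘ (U.mkℚᵘ (ℤ.+ 1) n))) (U.*≡* (cong (λ m → ℤ.+ suc m) eq))))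
  where
  eq : n ℕ.* 1 ℕ.* 1 ≡ n ℕ.+ 0 ℕ.+ 0
  eq = trans (ℕP.*-identityʳ (n ℕ.* 1)) (trans (ℕP.*-identityʳ n) (sym (trans (ℕP.+-identityʳ (n ℕ.+ 0)) (ℕP.+-identityʳ n))))

*-inverseʳ-unique : ∀ a {y z} → a * y ≡ 1ℚ → a * z ≡ 1ℚ → y ≡ z
*-inverseʳ-unique a {y} {z} ay≡1 az≡1 = begin
  y            ≡⟨ sym (*-identityʳ y) ⟩
  y * 1ℚ       ≡⟨ cong (y *_) (sym az≡1) ⟩
  y * (a * z)  ≡⟨ solve 3 (λ a y z → y :* (a :* z) := (a :* y) :* z) refl a y z ⟩
  (a * y) * z  ≡⟨ cong (_* z) ay≡1 ⟩
  1ℚ * z       ≡⟨ *-identityˡ z ⟩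
  z            ∎
  where open ≡-Reasoning

*-cancelˡ-≡0 : ∀ {a b x} → a * b ≡ 1ℚ → b * x ≡ 0ℚ → x ≡ 0ℚ
*-cancelˡ-≡0 {a} {b} {x} ab≡1 bx≡0 = begin
  x             ≡⟨ sym (*-identityˡ x) ⟩
  1ℚ * x        ≡⟨ cong (_* x) (sym ab≡1) ⟩
  (a * b) * x   ≡⟨ *-assoc a b x ⟩
  a * (b * x)   ≡⟨ cong (a *_) bx≡0 ⟩
  a * 0ℚ        ≡⟨ *-zeroʳ a ⟩
  0ℚ            ∎
  where open ≡-Reasoning

ℕ→ℚ-cancelˡ-≡0 : ∀ n .{{_ : NonZero n}} {x} → ℕ→ℚ n * x ≡ 0ℚ → x ≡ 0ℚ
ℕ→ℚ-cancelˡ-≡0 n = *-cancelˡ-≡0 {ℤ.+ 1 / n} (trans (*-comm (ℤ.+ 1 / n) (ℕ→ℚ n)) (ℕ→ℚ-inverseʳ n))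

^ℚ-distribʳ-* : ∀ x y n → (x * y) ^ℚ n ≡ (x ^ℚ n) * (y ^ℚ n)
^ℚ-distribʳ-* x y zero    = refl
^ℚ-distribʳ-* x y (suc n) = trans (cong ((x * y) *_) (^ℚ-distribʳ-* x y n))
  (solve 4 (λ x y a b → (x :* y) :* (a :* b) := (x :* a) :* (y :* b)) refl x y (x ^ℚ n) (y ^ℚ n))

^ℚ-distribˡ-+-* : ∀ x a b → x ^ℚ (a ℕ.+ b) ≡ (x ^ℚ a) * (x ^ℚ b)
^ℚ-distribˡ-+-* x zero    b = sym (*-identityˡ _)
^ℚ-distribˡ-+-* x (suc a) b = trans (cong (x *_) (^ℚ-distribˡ-+-* x a b)) (sym (*-assoc x _ _))

^ℚ-zeroˡ : ∀ n → 1ℚ ^ℚ n ≡ 1ℚ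
^ℚ-zeroˡ zero    = refl
^ℚ-zeroˡ (suc n) = cong (1ℚ *_) (^ℚ-zeroˡ n)

Σ-cong : ∀ n {f g : Fin n → ℚ} → (∀ i → f i ≡ g i) → Σ[<] n f ≡ Σ[<] n g
Σ-cong zero    f≗g = refl
Σ-cong (suc n) f≗g = cong₂ _+_ (f≗g F.zero) (Σ-cong n (f≗g ∘ F.suc))

*-distribˡ-Σ : ∀ n a (f : Fin n → ℚ) → a * Σ[<] n f ≡ Σ[<] n (λ i → a * f i)
*-distribˡ-Σ zero    a f = *-zeroʳ a
*-distribˡ-Σ (suc n) a f = trans (*-distribˡ-+ a (f F.zero) _) (cong (a * f F.zero +_) (*-distribˡ-Σ n a (f ∘ F.suc)))

*-distribʳ-Σ : ∀ n a (f : Fin n → ℚ) → Σ[<] n f * a ≡ Σ[<] n (λ i → f i * a)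
*-distribʳ-Σ n a f = trans (*-comm (Σ[<] n f) a) (trans (*-distribˡ-Σ n a f) (Σ-cong n (λ i → *-comm a (f i))))

Σ-distrib-+ : ∀ n (f g : Fin n → ℚ) → Σ[<] n (λ i → f i + g i) ≡ Σ[<] n f + Σ[<] n g
Σ-distrib-+ zero    f g = refl
Σ-distrib-+ (suc n) f g = trans (cong (f F.zero + g F.zero +_) (Σ-distrib-+ n (f ∘ F.suc) (g ∘ F.suc)))
  (solve 4 (λ a b c d → (a :+ b) :+ (c :+ d) := (a :+ c) :+ (b :+ d)) refl (f F.zero) (g F.zero) _ _)

Σ-distrib-neg : ∀ n (f : Fin n → ℚ) → Σ[<] n (λ i → - f i) ≡ - Σ[<] n f
Σ-distrib-neg zero    f = refl
Σ-distrib-neg (suc n) f = trans (cong (- f F.zero +_) (Σ-distrib-neg n (f ∘ F.suc)))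
  (solve 2 (λ a b → (:- a) :+ (:- b) := :- (a :+ b)) refl (f F.zero) _)

Σ-distrib-- : ∀ n (f g : Fin n → ℚ) → Σ[<] n (λ i → f i - g i) ≡ Σ[<] n f - Σ[<] n g
Σ-distrib-- n f g = trans (Σ-distrib-+ n f (λ i → - g i)) (cong (Σ[<] n f +_) (Σ-distrib-neg n g))

Σ-zero : ∀ n {f : Fin n → ℚ} → (∀ i → f i ≡ 0ℚ) → Σ[<] n f ≡ 0ℚ
Σ-zero zero    f≗0 = refl
Σ-zero (suc n) f≗0 = trans (cong₂ _+_ (f≗0 F.zero) (Σ-zero n (f≗0 ∘ F.suc))) (+-identityˡ 0ℚ)

Σ≡sum : ∀ n (f : Fin n → ℚ) → Σ[<] n f ≡ Sum.sum f
Σ≡sum zero    f = refl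
Σ≡sum (suc n) f = cong (f F.zero +_) (Σ≡sum n (f ∘ F.suc))

Σ-comm : ∀ m n (f : Fin m → Fin n → ℚ) →
  Σ[<] m (λ i → Σ[<] n (f i)) ≡ Σ[<] n (λ j → Σ[<] m (λ i → f i j))
Σ-comm m n f = begin
  Σ[<] m (λ i → Σ[<] n (f i))               ≡⟨ Σ-cong m (λ i → Σ≡sum n (f i)) ⟩
  Σ[<] m (λ i → Sum.sum (f i))              ≡⟨ Σ≡sum m _ ⟩
  Sum.sum (λ i → Sum.sum (f i))             ≡⟨ Sum.∑-comm f ⟩
  Sum.sum (λ j → Sum.sum (λ i → f i j))     ≡⟨ sym (Σ≡sum n _) ⟩
  Σ[<] n (λ j → Sum.sum (λ i → f i j))      ≡⟨ sym (Σ-cong n (λ j → Σ≡sum m (λ i → f i j))) ⟩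
  Σ[<] n (λ j → Σ[<] m (λ i → f i j))       ∎
  where open ≡-Reasoning

sumℕ : ℕ → (ℕ → ℚ) → ℚ
sumℕ k f = Σ[<] k (f ∘ toℕ)

sumℕ-cong : ∀ k {f g : ℕ → ℚ} → (∀ j → j < k → f j ≡ g j) → sumℕ k f ≡ sumℕ k g
sumℕ-cong k f≗g = Σ-cong k (λ m → f≗g (toℕ m) (FP.toℕ<n m))

sumℕ-distrib-+ : ∀ k (f g : ℕ → ℚ) → sumℕ k (λ j → f j + g j) ≡ sumℕ k f + sumℕ k g
sumℕ-distrib-+ k f g = Σ-distrib-+ k (f ∘ toℕ) (g ∘ toℕ)

sumℕ-distrib-- : ∀ k (f g : ℕ → ℚ) → sumℕ k (λ j → f j - g j) ≡ sumℕ k f - sumℕ k g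
sumℕ-distrib-- k f g = Σ-distrib-- k (f ∘ toℕ) (g ∘ toℕ)

*-distribˡ-sumℕ : ∀ k a (f : ℕ → ℚ) → a * sumℕ k f ≡ sumℕ k (λ j → a * f j)
*-distribˡ-sumℕ k a f = *-distribˡ-Σ k a (f ∘ toℕ)

sumℕ-const : ∀ k c → sumℕ k (λ _ → c) ≡ ℕ→ℚ k * c
sumℕ-const zero    c = sym (*-zeroˡ c)
sumℕ-const (suc k) c = begin
  c + sumℕ k (λ _ → c)   ≡⟨ cong (c +_) (sumℕ-const k c) ⟩
  c + ℕ→ℚ k * c          ≡⟨ solve 2 (λ c x → c :+ x :* c := (con 1ℚ :+ x) :* c) refl c (ℕ→ℚ k) ⟩
  (1ℚ + ℕ→ℚ k) * c       ≡⟨ cong (_* c) (sym (ℕ→ℚ-+ 1 k)) ⟩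
  ℕ→ℚ (suc k) * c        ∎
  where open ≡-Reasoning

δ : ℕ → ℕ → ℚ
δ a b = if a ℕ.≡ᵇ b then 1ℚ else 0ℚ

δ-refl : ∀ a → δ a a ≡ 1ℚ
δ-refl zero    = refl
δ-refl (suc a) = δ-refl a

δ-≢ : ∀ {a b} → a ≢ b → δ a b ≡ 0ℚ
δ-≢ {zero}  {zero}  a≢b = ⊥-elim (a≢b refl)
δ-≢ {zero}  {suc b} a≢b = refl
δ-≢ {suc a} {zero}  a≢b = refl
δ-≢ {suc a} {suc b} a≢b = δ-≢ (a≢b ∘ cong suc)

δ-sym : ∀ a b → δ a b ≡ δ b a
δ-sym zero    zero    = refl
δ-sym zero    (suc b) = refl
δ-sym (suc a) zero    = refl
δ-sym (suc a) (suc b) = δ-sym a b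

sumℕ-δˡ : ∀ k r (h : ℕ → ℚ) → r < k → sumℕ k (λ j → h j * δ j r) ≡ h r
sumℕ-δˡ (suc k) zero    h r<k = trans (cong₂ _+_ (*-identityʳ (h 0)) (Σ-zero k (λ m → *-zeroʳ (h (suc (toℕ m))))))
  (+-identityʳ (h 0))
sumℕ-δˡ (suc k) (suc r) h (s<s r<k) = trans (cong (_+ sumℕ k (λ j → h (suc j) * δ j r)) (*-zeroʳ (h 0)))
  (trans (+-identityˡ _) (sumℕ-δˡ k r (h ∘ suc) r<k))

sumℕ-δʳ : ∀ k r (h : ℕ → ℚ) → r < k → sumℕ k (λ j → δ r j * h j) ≡ h r
sumℕ-δʳ k r h r<k = trans (sumℕ-cong k (λ j _ → trans (*-comm (δ r j) (h j)) (cong (h j *_) (δ-sym r j))))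
  (sumℕ-δˡ k r h r<k)

clampFin : (K : ℕ) → ℕ → Fin (suc K)
clampFin K       zero    = F.zero
clampFin zero    (suc r) = F.zero
clampFin (suc K) (suc r) = F.suc (clampFin K r)

clampFin-toℕ : ∀ K (m : Fin (suc K)) → clampFin K (toℕ m) ≡ m
clampFin-toℕ K       F.zero    = refl
clampFin-toℕ (suc K) (F.suc m) = cong F.suc (clampFin-toℕ K m)

toℕ-clampFin : ∀ K r → r ≤ K → toℕ (clampFin K r) ≡ r
toℕ-clampFin K       zero    _         = refl
toℕ-clampFin (suc K) (suc r) (s≤s r≤K) = cong suc (toℕ-clampFin K r r≤K)

-- Arguments at or beyond the order give junk values.
permℕ : Perm → ℕ → ℕ
permℕ (perm zero    σ) r = r
permℕ (perm (suc K) σ) r = toℕ (σ ⟨$⟩ʳ clampFin K r)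

permℕ-toℕ : ∀ p (a : Fin (order p)) → permℕ p (toℕ a) ≡ toℕ (π p ⟨$⟩ʳ a)
permℕ-toℕ (perm (suc K) σ) a = cong (λ b → toℕ (σ ⟨$⟩ʳ b)) (clampFin-toℕ K a)

permℕ-< : ∀ p {k r} → order p ≡ k → r < k → permℕ p r < k
permℕ-< (perm (suc K) σ) refl _ = FP.toℕ<n (σ ⟨$⟩ʳ _)

permℕ-injective : ∀ p {k a b} → order p ≡ k → a < k → b < k → permℕ p a ≡ permℕ p b → a ≡ b
permℕ-injective (perm (suc K) σ) {a = a} {b} refl (s≤s a≤K) (s≤s b≤K) pa≡pb = begin
  a                      ≡⟨ sym (toℕ-clampFin K a a≤K) ⟩
  toℕ (clampFin K a)     ≡⟨ cong toℕ (trans (sym (inverseˡ σ)) (trans (cong (σ ⟨$⟩ˡ_) (FP.toℕ-injective pa≡pb)) (inverseˡ σ))) ⟩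
  toℕ (clampFin K b)     ≡⟨ toℕ-clampFin K b b≤K ⟩
  b                      ∎
  where open ≡-Reasoning

sumℕ-permℕ : ∀ p {k} (f : ℕ → ℚ) → order p ≡ k → sumℕ k (f ∘ permℕ p) ≡ sumℕ k f
sumℕ-permℕ p@(perm k σ) f refl = begin
  Σ[<] k (λ m → f (permℕ p (toℕ m)))      ≡⟨ Σ-cong k (λ m → cong f (permℕ-toℕ p m)) ⟩
  Σ[<] k (λ m → f (toℕ (σ ⟨$⟩ʳ m)))        ≡⟨ Σ≡sum k _ ⟩
  Sum.sum (λ m → f (toℕ (σ ⟨$⟩ʳ m)))       ≡⟨ sym (Sum.sum-permute (f ∘ toℕ) σ) ⟩
  Sum.sum {k} (f ∘ toℕ)                   ≡⟨ sym (Σ≡sum k _) ⟩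
  Σ[<] k (f ∘ toℕ)                        ∎
  where open ≡-Reasoning

agree⇒samePerm : ∀ p q → order p ≡ order q → (∀ r → r < order p → permℕ p r ≡ permℕ q r) → SamePerm p q
agree⇒samePerm p q op≡oq agree = op≡oq , λ i j i≡j →
  trans (sym (permℕ-toℕ p i)) (trans (agree (toℕ i) (FP.toℕ<n i)) (trans (cong (permℕ q) i≡j) (permℕ-toℕ q j)))

different⇒differ-somewhere : ∀ p q → order p ≡ order q → ¬ SamePerm p q →
  ∃[ r ] r < order p × permℕ p r ≢ permℕ q r
different⇒differ-somewhere p q op≡oq ¬p≈q
  with FP.all? (λ i → permℕ p (toℕ i) ℕP.≟ permℕ q (toℕ i))
... | yes agree = ⊥-elim (¬p≈q (agree⇒samePerm p q op≡oq (λ r r<o → subst (λ r → permℕ p r ≡ permℕ q r)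
                                    (FP.toℕ-fromℕ< r<o) (agree (F.fromℕ< r<o)))))
... | no ¬agree = let (i , differ) = FP.¬∀⟶∃¬ _ _ (λ i → permℕ p (toℕ i) ℕP.≟ permℕ q (toℕ i)) ¬agree
                  in toℕ i , FP.toℕ<n i , differ

-- Polynomials as coefficient lists

eval : List ℚ → ℚ → ℚ
eval []       y = 0ℚ
eval (c ∷ cs) y = c + y * eval cs y

quotientAt : ℚ → List ℚ → List ℚ
quotientAt a []            = []
quotientAt a (c ∷ [])      = []
quotientAt a (c ∷ c′ ∷ cs) = eval (c′ ∷ cs) a ∷ quotientAt a (c′ ∷ cs)

eval-quotientAt : ∀ a cs y → eval cs y ≡ (y - a) * eval (quotientAt a cs) y + eval cs a
eval-quotientAt a []            y = solve 2 (λ y a → con 0ℚ := (y :- a) :* con 0ℚ :+ con 0ℚ) refl y a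
eval-quotientAt a (c ∷ [])      y = solve 3 (λ c y a → c :+ y :* con 0ℚ := (y :- a) :* con 0ℚ :+ (c :+ a :* con 0ℚ)) refl c y a
eval-quotientAt a (c ∷ c′ ∷ cs) y = trans (cong (λ z → c + y * z) (eval-quotientAt a (c′ ∷ cs) y))
  (solve 5 (λ c y a q r → c :+ y :* ((y :- a) :* q :+ r) := (y :- a) :* (r :+ y :* q) :+ (c :+ a :* r)) refl
    c y a (eval (quotientAt a (c′ ∷ cs)) y) (eval (c′ ∷ cs) a))

length-quotientAt : ∀ a cs → length (quotientAt a cs) ≡ ℕ.pred (length cs)
length-quotientAt a []            = refl
length-quotientAt a (c ∷ [])      = refl
length-quotientAt a (c ∷ c′ ∷ cs) = cong suc (length-quotientAt a (c′ ∷ cs))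

root∧quotient≡0⇒≡0 : ∀ a cs → All (_≡ 0ℚ) (quotientAt a cs) → eval cs a ≡ 0ℚ → All (_≡ 0ℚ) cs
root∧quotient≡0⇒≡0 a []            _               _      = []
root∧quotient≡0⇒≡0 a (c ∷ [])      _               pa≡0   = trans (sym (trans (cong (c +_) (*-zeroʳ a)) (+-identityʳ c))) pa≡0 ∷ []
root∧quotient≡0⇒≡0 a (c ∷ c′ ∷ cs) (p′a≡0 ∷ q≡0) pa≡0 =
  trans (sym (trans (cong (λ z → c + a * z) p′a≡0) (trans (cong (c +_) (*-zeroʳ a)) (+-identityʳ c)))) pa≡0
  ∷ root∧quotient≡0⇒≡0 a (c′ ∷ cs) q≡0 p′a≡0

vanishes-from⇒≡0 : ∀ L cs a → length cs ≡ L → (∀ n → eval cs (ℕ→ℚ (a ℕ.+ n)) ≡ 0ℚ) → All (_≡ 0ℚ) cs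
vanishes-from⇒≡0 L       []         a _     _ = []
vanishes-from⇒≡0 zero    (_ ∷ _)    a ()    _
vanishes-from⇒≡0 (suc L) cs@(_ ∷ _) a |cs|≡ vanish =
  root∧quotient≡0⇒≡0 ℕa cs (vanishes-from⇒≡0 L q (suc a) |q|≡ q-vanish) root
  where
  ℕa = ℕ→ℚ a
  q = quotientAt ℕa cs
  root : eval cs ℕa ≡ 0ℚ
  root = subst (λ m → eval cs (ℕ→ℚ m) ≡ 0ℚ) (ℕP.+-identityʳ a) (vanish 0)
  |q|≡ : length q ≡ L
  |q|≡ = trans (length-quotientAt ℕa cs) (cong ℕ.pred |cs|≡)
  gap : ∀ n → ℕ→ℚ (suc a ℕ.+ n) - ℕa ≡ ℕ→ℚ (suc n)
  gap n = trans (cong (_- ℕa) (trans (cong ℕ→ℚ (sym (ℕP.+-suc a n))) (ℕ→ℚ-+ a (suc n))))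
    (solve 2 (λ a s → (a :+ s) :- a := s) refl ℕa (ℕ→ℚ (suc n)))
  q-vanish : ∀ n → eval q (ℕ→ℚ (suc a ℕ.+ n)) ≡ 0ℚ
  q-vanish n = ℕ→ℚ-cancelˡ-≡0 (suc n) (begin
    ℕ→ℚ (suc n) * eval q y                 ≡⟨ cong (_* eval q y) (sym (gap n)) ⟩
    (y - ℕa) * eval q y                    ≡⟨ sym (+-identityʳ _) ⟩
    (y - ℕa) * eval q y + 0ℚ               ≡⟨ cong ((y - ℕa) * eval q y +_) (sym root) ⟩
    (y - ℕa) * eval q y + eval cs ℕa       ≡⟨ sym (eval-quotientAt ℕa cs y) ⟩
    eval cs y                              ≡⟨ subst (λ m → eval cs (ℕ→ℚ m) ≡ 0ℚ) (ℕP.+-suc a n) (vanish (suc n)) ⟩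
    0ℚ                                     ∎)
    where
    open ≡-Reasoning
    y = ℕ→ℚ (suc a ℕ.+ n)

vanishes-on-ℕ⇒≡0 : ∀ cs → (∀ n → eval cs (ℕ→ℚ n) ≡ 0ℚ) → All (_≡ 0ℚ) cs
vanishes-on-ℕ⇒≡0 cs = vanishes-from⇒≡0 (length cs) cs 0 refl

coeffList : ℕ → (ℕ → ℚ) → List ℚ
coeffList zero    c = []
coeffList (suc d) c = c 0 ∷ coeffList d (c ∘ suc)

coeffList≡0⇒≡0 : ∀ d c → All (_≡ 0ℚ) (coeffList d c) → ∀ s → s < d → c s ≡ 0ℚ
coeffList≡0⇒≡0 (suc d) c (c0≡0 ∷ _)  zero    _         = c0≡0
coeffList≡0⇒≡0 (suc d) c (_ ∷ cs≡0) (suc s) (s<s s<d) = coeffList≡0⇒≡0 d (c ∘ suc) cs≡0 s s<d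

vanishes-on-ℕ⇒coefficients≡0 : ∀ d c → (∀ n → eval (coeffList d c) (ℕ→ℚ n) ≡ 0ℚ) → ∀ s → s < d → c s ≡ 0ℚ
vanishes-on-ℕ⇒coefficients≡0 d c vanish = coeffList≡0⇒≡0 d c (vanishes-on-ℕ⇒≡0 (coeffList d c) vanish)

eval-coeffList-cong : ∀ d {f g : ℕ → ℚ} y → (∀ s → s < d → f s ≡ g s) → eval (coeffList d f) y ≡ eval (coeffList d g) y
eval-coeffList-cong zero    y f≗g = refl
eval-coeffList-cong (suc d) y f≗g =
  cong₂ (λ a b → a + y * b) (f≗g 0 z<s) (eval-coeffList-cong d y (λ s s<d → f≗g (suc s) (s<s s<d)))

eval-coeffList-Σ : ∀ d n (t : Fin n → ℚ) (c : Fin n → ℕ → ℚ) y →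
  eval (coeffList d (λ s → Σ[<] n (λ i → t i * c i s))) y ≡ Σ[<] n (λ i → t i * eval (coeffList d (c i)) y)
eval-coeffList-Σ zero    n t c y = sym (Σ-zero n (λ i → *-zeroʳ (t i)))
eval-coeffList-Σ (suc d) n t c y = begin
  Σ[<] n (λ i → t i * c i 0) + y * eval (coeffList d (λ s → Σ[<] n (λ i → t i * c i (suc s)))) y
    ≡⟨ cong (λ z → Σ[<] n (λ i → t i * c i 0) + y * z) (eval-coeffList-Σ d n t (λ i → c i ∘ suc) y) ⟩
  Σ[<] n (λ i → t i * c i 0) + y * Σ[<] n (λ i → t i * e i)
    ≡⟨ cong (Σ[<] n (λ i → t i * c i 0) +_) (*-distribˡ-Σ n y _) ⟩
  Σ[<] n (λ i → t i * c i 0) + Σ[<] n (λ i → y * (t i * e i))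
    ≡⟨ sym (Σ-distrib-+ n _ _) ⟩
  Σ[<] n (λ i → t i * c i 0 + y * (t i * e i))
    ≡⟨ Σ-cong n (λ i → solve 4 (λ t a y e → t :* a :+ y :* (t :* e) := t :* (a :+ y :* e)) refl (t i) (c i 0) y (e i)) ⟩
  Σ[<] n (λ i → t i * eval (coeffList (suc d) (c i)) y) ∎
  where
  open ≡-Reasoning
  e : Fin n → ℚ
  e i = eval (coeffList d (c i ∘ suc)) y

eval-coeffList-- : ∀ d (f g : ℕ → ℚ) y → eval (coeffList d (λ s → f s - g s)) y ≡ eval (coeffList d f) y - eval (coeffList d g) y
eval-coeffList-- zero    f g y = refl
eval-coeffList-- (suc d) f g y = trans (cong (λ z → f 0 - g 0 + y * z) (eval-coeffList-- d (f ∘ suc) (g ∘ suc) y))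
  (solve 5 (λ a b y e e′ → a :- b :+ y :* (e :- e′) := (a :+ y :* e) :- (b :+ y :* e′)) refl (f 0) (g 0) y _ _)

eval-coeffList-zero : ∀ d {f : ℕ → ℚ} y → (∀ s → f s ≡ 0ℚ) → eval (coeffList d f) y ≡ 0ℚ
eval-coeffList-zero zero    y f≗0 = refl
eval-coeffList-zero (suc d) y f≗0 = trans (cong₂ (λ a b → a + y * b) (f≗0 0) (eval-coeffList-zero d y (f≗0 ∘ suc)))
  (trans (cong (0ℚ +_) (*-zeroʳ y)) (+-identityˡ 0ℚ))

eval-coeffList-δ : ∀ d j (g : ℕ → ℚ) y → j < d → eval (coeffList d (λ s → g s * δ j s)) y ≡ g j * y ^ℚ j
eval-coeffList-δ (suc d) zero    g y _ = begin
  g 0 * 1ℚ + y * eval (coeffList d (λ s → g (suc s) * 0ℚ)) y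
    ≡⟨ cong (λ z → g 0 * 1ℚ + y * z) (eval-coeffList-zero d y (λ s → *-zeroʳ (g (suc s)))) ⟩
  g 0 * 1ℚ + y * 0ℚ
    ≡⟨ solve 2 (λ a y → a :* con 1ℚ :+ y :* con 0ℚ := a :* con 1ℚ) refl (g 0) y ⟩
  g 0 * 1ℚ ∎
  where open ≡-Reasoning
eval-coeffList-δ (suc d) (suc j) g y (s<s j<d) = begin
  g 0 * 0ℚ + y * eval (coeffList d (λ s → g (suc s) * δ j s)) y
    ≡⟨ cong (λ z → g 0 * 0ℚ + y * z) (eval-coeffList-δ d j (g ∘ suc) y j<d) ⟩
  g 0 * 0ℚ + y * (g (suc j) * y ^ℚ j)
    ≡⟨ solve 4 (λ a y b e → a :* con 0ℚ :+ y :* (b :* e) := b :* (y :* e)) refl (g 0) y (g (suc j)) (y ^ℚ j) ⟩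
  g (suc j) * y ^ℚ suc j ∎
  where open ≡-Reasoning

eval-coeffList-δ-≥ : ∀ d j (g : ℕ → ℚ) y → d ≤ j → eval (coeffList d (λ s → g s * δ j s)) y ≡ 0ℚ
eval-coeffList-δ-≥ zero    j       g y _         = refl
eval-coeffList-δ-≥ (suc d) (suc j) g y (s≤s d≤j) = begin
  g 0 * 0ℚ + y * eval (coeffList d (λ s → g (suc s) * δ j s)) y
    ≡⟨ cong₂ (λ a b → a + y * b) (*-zeroʳ (g 0)) (eval-coeffList-δ-≥ d j (g ∘ suc) y d≤j) ⟩
  0ℚ + y * 0ℚ
    ≡⟨ trans (cong (0ℚ +_) (*-zeroʳ y)) (+-identityˡ 0ℚ) ⟩
  0ℚ ∎
  where open ≡-Reasoning

All≡0⇒eval≡0 : ∀ cs y → All (_≡ 0ℚ) cs → eval cs y ≡ 0ℚ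
All≡0⇒eval≡0 []       y []             = refl
All≡0⇒eval≡0 (c ∷ cs) y (c≡0 ∷ cs≡0) = trans (cong₂ (λ a b → a + y * b) c≡0 (All≡0⇒eval≡0 cs y cs≡0))
  (trans (cong (0ℚ +_) (*-zeroʳ y)) (+-identityˡ 0ℚ))

addCoeffs : List ℚ → List ℚ → List ℚ
addCoeffs []       ds       = ds
addCoeffs (c ∷ cs) []       = c ∷ cs
addCoeffs (c ∷ cs) (d ∷ ds) = c + d ∷ addCoeffs cs ds

eval-addCoeffs : ∀ cs ds y → eval (addCoeffs cs ds) y ≡ eval cs y + eval ds y
eval-addCoeffs []       ds       y = sym (+-identityˡ _)
eval-addCoeffs (c ∷ cs) []       y = sym (+-identityʳ _)
eval-addCoeffs (c ∷ cs) (d ∷ ds) y = trans (cong (λ z → c + d + y * z) (eval-addCoeffs cs ds y))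
  (solve 5 (λ c d y e e′ → c :+ d :+ y :* (e :+ e′) := (c :+ y :* e) :+ (d :+ y :* e′)) refl c d y (eval cs y) (eval ds y))

eval-scaleCoeffs : ∀ a cs y → eval (map (a *_) cs) y ≡ a * eval cs y
eval-scaleCoeffs a []       y = sym (*-zeroʳ a)
eval-scaleCoeffs a (c ∷ cs) y = trans (cong (λ z → a * c + y * z) (eval-scaleCoeffs a cs y))
  (solve 4 (λ a c y e → a :* c :+ y :* (a :* e) := a :* (c :+ y :* e)) refl a c y (eval cs y))

IsPolynomial : (ℚ → ℚ) → Set
IsPolynomial f = ∃[ cs ] ∀ y → f y ≡ eval cs y

isPolynomial-+ : ∀ {f g} → IsPolynomial f → IsPolynomial g → IsPolynomial (λ y → f y + g y)
isPolynomial-+ (cs , f≗) (ds , g≗) = addCoeffs cs ds , λ y → trans (cong₂ _+_ (f≗ y) (g≗ y)) (sym (eval-addCoeffs cs ds y))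

isPolynomial-scale : ∀ a {f} → IsPolynomial f → IsPolynomial (λ y → a * f y)
isPolynomial-scale a (cs , f≗) = map (a *_) cs , λ y → trans (cong (a *_) (f≗ y)) (sym (eval-scaleCoeffs a cs y))

isPolynomial-*X : ∀ {f} → IsPolynomial f → IsPolynomial (λ y → y * f y)
isPolynomial-*X (cs , f≗) = 0ℚ ∷ cs , λ y → trans (cong (y *_) (f≗ y)) (sym (+-identityˡ _))

isPolynomial-cong : ∀ {f g} → (∀ y → f y ≡ g y) → IsPolynomial f → IsPolynomial g
isPolynomial-cong f≗g (cs , f≗) = cs , λ y → trans (sym (f≗g y)) (f≗ y)

isPolynomial-*[1+X]^ : ∀ e {f} → IsPolynomial f → IsPolynomial (λ y → (1ℚ + y) ^ℚ e * f y)
isPolynomial-*[1+X]^ zero    {f} = isPolynomial-cong (λ y → sym (*-identityˡ (f y)))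
isPolynomial-*[1+X]^ (suc e) {f} f-poly = isPolynomial-cong expand (isPolynomial-+ g-poly (isPolynomial-*X g-poly))
  where
  g-poly = isPolynomial-*[1+X]^ e f-poly
  expand : ∀ y → (1ℚ + y) ^ℚ e * f y + y * ((1ℚ + y) ^ℚ e * f y) ≡ (1ℚ + y) ^ℚ suc e * f y
  expand y = solve 3 (λ y p f → p :* f :+ y :* (p :* f) := ((con 1ℚ :+ y) :* p) :* f) refl y ((1ℚ + y) ^ℚ e) (f y)

polynomial-vanishes-on-ℕ⇒≡0 : ∀ {f} → IsPolynomial f → (∀ n → f (ℕ→ℚ n) ≡ 0ℚ) → ∀ y → f y ≡ 0ℚ
polynomial-vanishes-on-ℕ⇒≡0 (cs , f≗) vanish y =
  trans (f≗ y) (All≡0⇒eval≡0 cs y (vanishes-on-ℕ⇒≡0 cs (λ n → trans (sym (f≗ (ℕ→ℚ n))) (vanish n))))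

invFact : ℕ → ℕ → ℚ
invFact a b = (ℤ.+ 1 / (a ! ℕ.* b !)) {{_!*_!≢0 a b}}

invFact-inverse : ∀ a b → ℕ→ℚ (a ! ℕ.* b !) * invFact a b ≡ 1ℚ
invFact-inverse a b = ℕ→ℚ-inverseʳ (a ! ℕ.* b !) {{_!*_!≢0 a b}}

invFact-positive : ∀ a b → Positive (invFact a b)
invFact-positive a b = normalize-pos 1 (a ! ℕ.* b !) {{_!*_!≢0 a b}}

invFact-cancelˡ-≡0 : ∀ a b {x} → invFact a b * x ≡ 0ℚ → x ≡ 0ℚ
invFact-cancelˡ-≡0 a b = *-cancelˡ-≡0 {ℕ→ℚ (a ! ℕ.* b !)} (invFact-inverse a b)

invFact-sucʳ : ∀ a b → ℕ→ℚ (suc b) * invFact a (suc b) ≡ invFact a b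
invFact-sucʳ a b = *-inverseʳ-unique (ℕ→ℚ (a ! ℕ.* b !)) (begin
  ℕ→ℚ (a ! ℕ.* b !) * (ℕ→ℚ (suc b) * invFact a (suc b))
    ≡⟨ solve 3 (λ x y z → x :* (y :* z) := (y :* x) :* z) refl (ℕ→ℚ (a ! ℕ.* b !)) (ℕ→ℚ (suc b)) (invFact a (suc b)) ⟩
  (ℕ→ℚ (suc b) * ℕ→ℚ (a ! ℕ.* b !)) * invFact a (suc b)
    ≡⟨ cong (_* invFact a (suc b)) (sym (trans (cong ℕ→ℚ factorials) (ℕ→ℚ-* (suc b) (a ! ℕ.* b !)))) ⟩
  ℕ→ℚ (a ! ℕ.* suc b !) * invFact a (suc b)
    ≡⟨ invFact-inverse a (suc b) ⟩
  1ℚ ∎) (invFact-inverse a b)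
  where
  open ≡-Reasoning
  factorials : a ! ℕ.* suc b ! ≡ suc b ℕ.* (a ! ℕ.* b !)
  factorials = trans (sym (ℕP.*-assoc (a !) (suc b) (b !)))
    (trans (cong (ℕ._* b !) (ℕP.*-comm (a !) (suc b))) (ℕP.*-assoc (suc b) (a !) (b !)))

invFact-comm : ∀ a b → invFact a b ≡ invFact b a
invFact-comm a b = *-inverseʳ-unique (ℕ→ℚ (a ! ℕ.* b !)) (invFact-inverse a b)
  (trans (cong (λ m → ℕ→ℚ m * invFact b a) (ℕP.*-comm (a !) (b !))) (invFact-inverse b a))

invFact-sucˡ : ∀ a b → ℕ→ℚ (suc a) * invFact (suc a) b ≡ invFact a b
invFact-sucˡ a b = trans (cong (ℕ→ℚ (suc a) *_) (invFact-comm (suc a) b))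
  (trans (invFact-sucʳ b a) (invFact-comm b a))

bernsteinWeight : ℕ → ℕ → ℚ
bernsteinWeight D s = invFact s (D ∸ s)

weightedMonomial : ℕ → ℕ → ℚ → ℚ
weightedMonomial D j = eval (coeffList (suc D) (λ s → bernsteinWeight D s * δ j s))

weightedMonomial-≤ : ∀ D j y → j ≤ D → weightedMonomial D j y ≡ bernsteinWeight D j * y ^ℚ j
weightedMonomial-≤ D j y j≤D = eval-coeffList-δ (suc D) j (bernsteinWeight D) y (s≤s j≤D)

weightedMonomial-suc : ∀ D y → weightedMonomial D (suc D) y ≡ 0ℚ
weightedMonomial-suc D y = eval-coeffList-δ-≥ (suc D) (suc D) (bernsteinWeight D) y ℕP.≤-refl

factorCoeff : ℕ → ℕ → ℕ → ℚ
factorCoeff D j s = bernsteinWeight D s * (δ j s - δ j (suc s))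

factorPoly : ℕ → ℕ → ℚ → ℚ
factorPoly D j = eval (coeffList (suc D) (factorCoeff D j))

factorPoly-difference : ∀ D j y →
  factorPoly D j y ≡ weightedMonomial D j y - eval (coeffList (suc D) (λ s → bernsteinWeight D s * δ j (suc s))) y
factorPoly-difference D j y = trans (eval-coeffList-cong (suc D) y (λ s _ → distrib s))
  (eval-coeffList-- (suc D) (λ s → bernsteinWeight D s * δ j s) (λ s → bernsteinWeight D s * δ j (suc s)) y)
  where
  distrib : ∀ s → factorCoeff D j s ≡ bernsteinWeight D s * δ j s - bernsteinWeight D s * δ j (suc s)
  distrib s = solve 3 (λ w a b → w :* (a :- b) := w :* a :- w :* b) refl (bernsteinWeight D s) (δ j s) (δ j (suc s))

factorPoly-zero : ∀ D y → factorPoly D 0 y ≡ weightedMonomial D 0 y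
factorPoly-zero D y = begin
  factorPoly D 0 y
    ≡⟨ factorPoly-difference D 0 y ⟩
  weightedMonomial D 0 y - eval (coeffList (suc D) (λ s → bernsteinWeight D s * 0ℚ)) y
    ≡⟨ cong (λ z → weightedMonomial D 0 y - z) (eval-coeffList-zero (suc D) y (λ s → *-zeroʳ (bernsteinWeight D s))) ⟩
  weightedMonomial D 0 y - 0ℚ
    ≡⟨ +-identityʳ _ ⟩
  weightedMonomial D 0 y ∎
  where open ≡-Reasoning

factorPoly-suc : ∀ D j y → factorPoly D (suc j) y ≡ weightedMonomial D (suc j) y - weightedMonomial D j y
factorPoly-suc D j = factorPoly-difference D (suc j)

Σ-*-factorPoly : ∀ D (h : ℕ → ℚ) y → sumℕ (suc (suc D)) (λ r → h r * factorPoly D r y)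
  ≡ eval (coeffList (suc D) (λ s → bernsteinWeight D s * (h s - h (suc s)))) y
Σ-*-factorPoly D h y = begin
  sumℕ k (λ r → h r * factorPoly D r y)
    ≡⟨ sym (eval-coeffList-Σ (suc D) k (h ∘ toℕ) (factorCoeff D ∘ toℕ) y) ⟩
  eval (coeffList (suc D) (λ s → sumℕ k (λ r → h r * factorCoeff D r s))) y
    ≡⟨ eval-coeffList-cong (suc D) y (λ s s≤D → coefficient s (s<s s≤D)) ⟩
  eval (coeffList (suc D) (λ s → bernsteinWeight D s * (h s - h (suc s)))) y ∎
  where
  open ≡-Reasoning
  k = suc (suc D)
  coefficient : ∀ s → suc s < k → sumℕ k (λ r → h r * factorCoeff D r s) ≡ bernsteinWeight D s * (h s - h (suc s))
  coefficient s s+1<k = begin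
    sumℕ k (λ r → h r * (w * (δ r s - δ r (suc s))))
      ≡⟨ sumℕ-cong k (λ r _ → solve 4 (λ h w a b → h :* (w :* (a :- b)) := w :* (h :* a) :- w :* (h :* b)) refl (h r) w (δ r s) (δ r (suc s))) ⟩
    sumℕ k (λ r → w * (h r * δ r s) - w * (h r * δ r (suc s)))
      ≡⟨ sumℕ-distrib-- k (λ r → w * (h r * δ r s)) (λ r → w * (h r * δ r (suc s))) ⟩
    sumℕ k (λ r → w * (h r * δ r s)) - sumℕ k (λ r → w * (h r * δ r (suc s)))
      ≡⟨ sym (cong₂ _-_ (*-distribˡ-sumℕ k w (λ r → h r * δ r s)) (*-distribˡ-sumℕ k w (λ r → h r * δ r (suc s)))) ⟩
    w * sumℕ k (λ r → h r * δ r s) - w * sumℕ k (λ r → h r * δ r (suc s))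
      ≡⟨ cong₂ (λ a b → w * a - w * b) (sumℕ-δˡ k s h (ℕP.<-trans (ℕP.n<1+n s) s+1<k)) (sumℕ-δˡ k (suc s) h s+1<k) ⟩
    w * h s - w * h (suc s)
      ≡⟨ solve 3 (λ w a b → w :* a :- w :* b := w :* (a :- b)) refl w (h s) (h (suc s)) ⟩
    w * (h s - h (suc s)) ∎
    where w = bernsteinWeight D s

factorPolys-independent : ∀ D (h : ℕ → ℚ) → (∀ N → sumℕ (suc (suc D)) (λ r → h r * factorPoly D r (ℕ→ℚ N)) ≡ 0ℚ) →
  ∀ r → r < suc (suc D) → h r ≡ h 0
factorPolys-independent D h vanish = constant
  where
  step≡0 : ∀ s → s < suc D → bernsteinWeight D s * (h s - h (suc s)) ≡ 0ℚ
  step≡0 = vanishes-on-ℕ⇒coefficients≡0 (suc D) _ (λ N → trans (sym (Σ-*-factorPoly D h (ℕ→ℚ N))) (vanish N))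
  constant : ∀ r → r < suc (suc D) → h r ≡ h 0
  constant zero    _         = refl
  constant (suc r) (s<s r<k) = trans (sym (x-y≡0⇒x≡y (h r) (h (suc r)) (invFact-cancelˡ-≡0 r (D ∸ r) (step≡0 r r<k))))
    (constant r (ℕP.<-trans r<k (ℕP.n<1+n _)))

-- The gradient factors at α = N/(N+1)

αN : ℕ → ℚ
αN N = ℕ→ℚ N * (ℤ.+ 1 / suc N)

cN : ℕ → ℚ
cN N = ℕ→ℚ (suc N)

1-αN : ∀ N → 1ℚ - αN N ≡ ℤ.+ 1 / suc N
1-αN N = begin
  1ℚ - n * u             ≡⟨ cong (_- n * u) (sym (ℕ→ℚ-inverseʳ (suc N))) ⟩
  ℕ→ℚ (suc N) * u - n * u ≡⟨ cong (λ m → m * u - n * u) (ℕ→ℚ-+ 1 N) ⟩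
  (1ℚ + n) * u - n * u   ≡⟨ solve 2 (λ n u → (con 1ℚ :+ n) :* u :- n :* u := u) refl n u ⟩
  u                      ∎
  where
  open ≡-Reasoning
  n = ℕ→ℚ N
  u = ℤ.+ 1 / suc N

αN-monomial : ∀ N a b → αN N ^ℚ a * (1ℚ - αN N) ^ℚ b * cN N ^ℚ (a ℕ.+ b) ≡ ℕ→ℚ N ^ℚ a
αN-monomial N a b = begin
  (n * u) ^ℚ a * (1ℚ - n * u) ^ℚ b * c ^ℚ (a ℕ.+ b)
    ≡⟨ cong₂ (λ p q → (n * u) ^ℚ a * q ^ℚ b * p) (^ℚ-distribˡ-+-* c a b) (1-αN N) ⟩
  (n * u) ^ℚ a * u ^ℚ b * (c ^ℚ a * c ^ℚ b)
    ≡⟨ cong (λ p → p * u ^ℚ b * (c ^ℚ a * c ^ℚ b)) (^ℚ-distribʳ-* n u a) ⟩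
  n ^ℚ a * u ^ℚ a * u ^ℚ b * (c ^ℚ a * c ^ℚ b)
    ≡⟨ solve 5 (λ A B C D E → A :* B :* C :* (D :* E) := A :* (B :* D) :* (C :* E)) refl (n ^ℚ a) (u ^ℚ a) (u ^ℚ b) (c ^ℚ a) (c ^ℚ b) ⟩
  n ^ℚ a * (u ^ℚ a * c ^ℚ a) * (u ^ℚ b * c ^ℚ b)
    ≡⟨ cong₂ (λ p q → n ^ℚ a * p * q) (sym (^ℚ-distribʳ-* u c a)) (sym (^ℚ-distribʳ-* u c b)) ⟩
  n ^ℚ a * (u * c) ^ℚ a * (u * c) ^ℚ b
    ≡⟨ cong (λ p → n ^ℚ a * p ^ℚ a * p ^ℚ b) (trans (*-comm u c) (ℕ→ℚ-inverseʳ (suc N))) ⟩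
  n ^ℚ a * 1ℚ ^ℚ a * 1ℚ ^ℚ b
    ≡⟨ cong₂ (λ p q → n ^ℚ a * p * q) (^ℚ-zeroˡ a) (^ℚ-zeroˡ b) ⟩
  n ^ℚ a * 1ℚ * 1ℚ
    ≡⟨ trans (*-identityʳ _) (*-identityʳ _) ⟩
  n ^ℚ a ∎
  where
  open ≡-Reasoning
  n = ℕ→ℚ N
  u = ℤ.+ 1 / suc N
  c = cN N

weightedMonomial-αN : ∀ N a b m r {D} → a ℕ.+ b ≡ D → m * r ≡ invFact a b →
  m * αN N ^ℚ a * (1ℚ - αN N) ^ℚ b * r * cN N ^ℚ D ≡ weightedMonomial D a (ℕ→ℚ N)
weightedMonomial-αN N a b m r refl mr≡ = begin
  m * x ^ℚ a * (1ℚ - x) ^ℚ b * r * cN N ^ℚ (a ℕ.+ b)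
    ≡⟨ solve 5 (λ m p q r c → m :* p :* q :* r :* c := (m :* r) :* (p :* q :* c)) refl m (x ^ℚ a) ((1ℚ - x) ^ℚ b) r (cN N ^ℚ (a ℕ.+ b)) ⟩
  (m * r) * (x ^ℚ a * (1ℚ - x) ^ℚ b * cN N ^ℚ (a ℕ.+ b))
    ≡⟨ cong₂ _*_ mr≡ (αN-monomial N a b) ⟩
  invFact a b * ℕ→ℚ N ^ℚ a
    ≡⟨ cong (λ d → invFact a d * ℕ→ℚ N ^ℚ a) (sym (ℕP.m+n∸m≡n a b)) ⟩
  bernsteinWeight (a ℕ.+ b) a * ℕ→ℚ N ^ℚ a
    ≡⟨ sym (weightedMonomial-≤ (a ℕ.+ b) a (ℕ→ℚ N) (ℕP.m≤m+n a b)) ⟩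
  weightedMonomial (a ℕ.+ b) a (ℕ→ℚ N) ∎
  where
  open ≡-Reasoning
  x = αN N

-- gradFactor k j = gradFactor′ j (k ∸ suc j) definitionally; abstracting the truncated
-- difference lets it be rewritten.
gradFactor′ : ℕ → ℕ → ℚ → ℚ
gradFactor′ j m x = (ℕ→ℚ m * x ^ℚ j * (1ℚ - x) ^ℚ (m ∸ 1) - ℕ→ℚ j * x ^ℚ (j ∸ 1) * (1ℚ - x) ^ℚ m) * invFact j m

split-difference : ∀ a b r c → (a - b) * r * c ≡ a * r * c - b * r * c
split-difference = solve 4 (λ a b r c → (a :- b) :* r :* c := a :* r :* c :- b :* r :* c) refl

zero-term : ∀ a b r c → 0ℚ * a * b * r * c ≡ 0ℚ
zero-term = solve 4 (λ a b r c → con 0ℚ :* a :* b :* r :* c := con 0ℚ) refl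

gradFactor′-αN : ∀ j q N → gradFactor′ j (suc q) (αN N) * cN N ^ℚ (j ℕ.+ q) ≡ factorPoly (j ℕ.+ q) j (ℕ→ℚ N)
gradFactor′-αN zero q N = begin
  gradFactor′ 0 (suc q) x * cN N ^ℚ q
    ≡⟨ split-difference (ℕ→ℚ (suc q) * x ^ℚ 0 * (1ℚ - x) ^ℚ q) (0ℚ * x ^ℚ 0 * (1ℚ - x) ^ℚ suc q) r (cN N ^ℚ q) ⟩
  ℕ→ℚ (suc q) * x ^ℚ 0 * (1ℚ - x) ^ℚ q * r * cN N ^ℚ q - 0ℚ * x ^ℚ 0 * (1ℚ - x) ^ℚ suc q * r * cN N ^ℚ q
    ≡⟨ cong₂ _-_ (weightedMonomial-αN N 0 q (ℕ→ℚ (suc q)) r refl (invFact-sucʳ 0 q)) (zero-term (x ^ℚ 0) ((1ℚ - x) ^ℚ suc q) r (cN N ^ℚ q)) ⟩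
  weightedMonomial q 0 (ℕ→ℚ N) - 0ℚ
    ≡⟨ trans (+-identityʳ _) (sym (factorPoly-zero q (ℕ→ℚ N))) ⟩
  factorPoly q 0 (ℕ→ℚ N) ∎
  where
  open ≡-Reasoning
  x = αN N
  r = invFact 0 (suc q)
gradFactor′-αN (suc i) q N = begin
  gradFactor′ (suc i) (suc q) x * cN N ^ℚ (suc i ℕ.+ q)
    ≡⟨ split-difference (ℕ→ℚ (suc q) * x ^ℚ suc i * (1ℚ - x) ^ℚ q) (ℕ→ℚ (suc i) * x ^ℚ i * (1ℚ - x) ^ℚ suc q) r (cN N ^ℚ (suc i ℕ.+ q)) ⟩
  ℕ→ℚ (suc q) * x ^ℚ suc i * (1ℚ - x) ^ℚ q * r * cN N ^ℚ (suc i ℕ.+ q)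
    - ℕ→ℚ (suc i) * x ^ℚ i * (1ℚ - x) ^ℚ suc q * r * cN N ^ℚ (suc i ℕ.+ q)
    ≡⟨ cong₂ _-_ (weightedMonomial-αN N (suc i) q (ℕ→ℚ (suc q)) r refl (invFact-sucʳ (suc i) q))
                 (weightedMonomial-αN N i (suc q) (ℕ→ℚ (suc i)) r (ℕP.+-suc i q) (invFact-sucˡ i (suc q))) ⟩
  weightedMonomial (suc i ℕ.+ q) (suc i) (ℕ→ℚ N) - weightedMonomial (suc i ℕ.+ q) i (ℕ→ℚ N)
    ≡⟨ sym (factorPoly-suc (suc i ℕ.+ q) i (ℕ→ℚ N)) ⟩
  factorPoly (suc i ℕ.+ q) (suc i) (ℕ→ℚ N) ∎
  where
  open ≡-Reasoning
  x = αN N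
  r = invFact (suc i) (suc q)

gradFactor′-αN-last : ∀ D N → gradFactor′ (suc D) 0 (αN N) * cN N ^ℚ D ≡ factorPoly D (suc D) (ℕ→ℚ N)
gradFactor′-αN-last D N = begin
  gradFactor′ (suc D) 0 x * cN N ^ℚ D
    ≡⟨ split-difference (0ℚ * x ^ℚ suc D * (1ℚ - x) ^ℚ 0) (ℕ→ℚ (suc D) * x ^ℚ D * (1ℚ - x) ^ℚ 0) r (cN N ^ℚ D) ⟩
  0ℚ * x ^ℚ suc D * (1ℚ - x) ^ℚ 0 * r * cN N ^ℚ D - ℕ→ℚ (suc D) * x ^ℚ D * (1ℚ - x) ^ℚ 0 * r * cN N ^ℚ D
    ≡⟨ cong₂ _-_ (trans (zero-term (x ^ℚ suc D) ((1ℚ - x) ^ℚ 0) r (cN N ^ℚ D)) (sym (weightedMonomial-suc D (ℕ→ℚ N))))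
                 (weightedMonomial-αN N D 0 (ℕ→ℚ (suc D)) r (ℕP.+-identityʳ D) (invFact-sucˡ D 0)) ⟩
  weightedMonomial D (suc D) (ℕ→ℚ N) - weightedMonomial D D (ℕ→ℚ N)
    ≡⟨ sym (factorPoly-suc D D (ℕ→ℚ N)) ⟩
  factorPoly D (suc D) (ℕ→ℚ N) ∎
  where
  open ≡-Reasoning
  x = αN N
  r = invFact (suc D) 0

gradFactor-αN : ∀ D j N → j < suc (suc D) → gradFactor (suc (suc D)) j (αN N) * cN N ^ℚ D ≡ factorPoly D j (ℕ→ℚ N)
gradFactor-αN D j N j<k with ℕP.m≤n⇒m<n∨m≡n (ℕP.≤-pred j<k)
... | inj₂ refl = trans (cong (λ m → gradFactor′ (suc D) m (αN N) * cN N ^ℚ D) (ℕP.n∸n≡0 D)) (gradFactor′-αN-last D N)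
... | inj₁ j<D+1 with (q , refl) ← ℕP.m≤n⇒∃[o]m+o≡n (ℕP.≤-pred j<D+1) =
  trans (cong (λ m → gradFactor′ j m (αN N) * cN N ^ℚ (j ℕ.+ q)) (trans (cong (_∸ j) (sym (ℕP.+-suc j q))) (ℕP.m+n∸m≡n j (suc q))))
        (gradFactor′-αN j q N)

scaledGradPoly : ℕ → Perm → ℚ → ℚ → ℚ
scaledGradPoly D p y z = sumℕ (suc (suc D)) (λ r → factorPoly D r y * factorPoly D (permℕ p r) z)

gradPoly-αN : ∀ p D N M → order p ≡ suc (suc D) →
  gradPoly p (αN N) (αN M) * (cN N ^ℚ D * cN M ^ℚ D) ≡ ℕ→ℚ (suc (suc D) !) * scaledGradPoly D p (ℕ→ℚ N) (ℕ→ℚ M)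
gradPoly-αN p@(perm k σ) D N M refl = begin
  (ℕ→ℚ (k !) * Σ[<] k f) * C          ≡⟨ *-assoc (ℕ→ℚ (k !)) (Σ[<] k f) C ⟩
  ℕ→ℚ (k !) * (Σ[<] k f * C)          ≡⟨ cong (ℕ→ℚ (k !) *_) (*-distribʳ-Σ k C f) ⟩
  ℕ→ℚ (k !) * Σ[<] k (λ m → f m * C)  ≡⟨ cong (ℕ→ℚ (k !) *_) (Σ-cong k scaled) ⟩
  ℕ→ℚ (k !) * scaledGradPoly D p (ℕ→ℚ N) (ℕ→ℚ M) ∎
  where
  open ≡-Reasoning
  C = cN N ^ℚ D * cN M ^ℚ D
  f : Fin k → ℚ
  f m = gradFactor k (toℕ m) (αN N) * gradFactor k (toℕ (σ ⟨$⟩ʳ m)) (αN M)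
  scaled : ∀ m → f m * C ≡ factorPoly D (toℕ m) (ℕ→ℚ N) * factorPoly D (permℕ p (toℕ m)) (ℕ→ℚ M)
  scaled m = trans (solve 4 (λ a b c d → (a :* b) :* (c :* d) := (a :* c) :* (b :* d)) refl
                      (gradFactor k (toℕ m) (αN N)) (gradFactor k (toℕ (σ ⟨$⟩ʳ m)) (αN M)) (cN N ^ℚ D) (cN M ^ℚ D))
    (cong₂ _*_ (gradFactor-αN D (toℕ m) N (FP.toℕ<n m))
               (trans (gradFactor-αN D (toℕ (σ ⟨$⟩ʳ m)) M (FP.toℕ<n (σ ⟨$⟩ʳ m))) (cong (λ j → factorPoly D j (ℕ→ℚ M)) (sym (permℕ-toℕ p m)))))

-- Relations among permutations of one order

LinRel : ∀ n → (Fin n → Perm) → (Fin n → ℚ) → Set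
LinRel n S t = ∀ α β → Σ[<] n (λ i → t i * gradPoly (S i) α β) ≡ 0ℚ

linRel-αN : ∀ n S t D → (∀ i → order (S i) ≡ suc (suc D)) → LinRel n S t →
  ∀ N M → Σ[<] n (λ i → t i * scaledGradPoly D (S i) (ℕ→ℚ N) (ℕ→ℚ M)) ≡ 0ℚ
linRel-αN n S t D ord rel N M = ℕ→ℚ-cancelˡ-≡0 (suc (suc D) !) {{suc (suc D) !≢0}} (begin
  K * Σ[<] n (λ i → t i * Z i)        ≡⟨ *-distribˡ-Σ n K _ ⟩
  Σ[<] n (λ i → K * (t i * Z i))      ≡⟨ Σ-cong n (λ i → trans (solve 3 (λ K t z → K :* (t :* z) := t :* (K :* z)) refl K (t i) (Z i))
                                             (cong (t i *_) (sym (gradPoly-αN (S i) D N M (ord i))))) ⟩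
  Σ[<] n (λ i → t i * (P i * C))      ≡⟨ Σ-cong n (λ i → sym (*-assoc (t i) (P i) C)) ⟩
  Σ[<] n (λ i → t i * P i * C)        ≡⟨ sym (*-distribʳ-Σ n C (λ i → t i * P i)) ⟩
  Σ[<] n (λ i → t i * P i) * C        ≡⟨ cong (_* C) (rel (αN N) (αN M)) ⟩
  0ℚ * C                              ≡⟨ *-zeroˡ C ⟩
  0ℚ                                  ∎)
  where
  open ≡-Reasoning
  K = ℕ→ℚ (suc (suc D) !)
  C = cN N ^ℚ D * cN M ^ℚ D
  Z P : Fin n → ℚ
  Z i = scaledGradPoly D (S i) (ℕ→ℚ N) (ℕ→ℚ M)
  P i = gradPoly (S i) (αN N) (αN M)

weightedPermMatrix : ∀ n → (Fin n → Perm) → (Fin n → ℚ) → ℕ → ℕ → ℚ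
weightedPermMatrix n S t r s = Σ[<] n (λ i → t i * δ (permℕ (S i) r) s)

sumℕ-Σ-comm : ∀ k n (t : Fin n → ℚ) (f : Fin n → ℕ → ℚ) →
  sumℕ k (λ s → Σ[<] n (λ i → t i * f i s)) ≡ Σ[<] n (λ i → t i * sumℕ k (f i))
sumℕ-Σ-comm k n t f = trans (Σ-comm k n (λ m i → t i * f i (toℕ m)))
  (Σ-cong n (λ i → sym (*-distribˡ-sumℕ k (t i) (f i))))

Σ-*-sumℕ-comm : ∀ k n (t : Fin n → ℚ) (a : Fin n → ℕ → ℚ) (y : ℕ → ℚ) →
  Σ[<] n (λ i → t i * sumℕ k (λ s → a i s * y s)) ≡ sumℕ k (λ s → Σ[<] n (λ i → t i * a i s) * y s)
Σ-*-sumℕ-comm k n t a y = begin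
  Σ[<] n (λ i → t i * sumℕ k (λ s → a i s * y s))    ≡⟨ sym (sumℕ-Σ-comm k n t (λ i s → a i s * y s)) ⟩
  sumℕ k (λ s → Σ[<] n (λ i → t i * (a i s * y s)))  ≡⟨ sumℕ-cong k (λ s _ → trans (Σ-cong n (λ i → sym (*-assoc (t i) (a i s) (y s))))
                                                          (sym (*-distribʳ-Σ n (y s) (λ i → t i * a i s)))) ⟩
  sumℕ k (λ s → Σ[<] n (λ i → t i * a i s) * y s)    ∎
  where open ≡-Reasoning

sumℕ-*-permℕ : ∀ k p → order p ≡ k → ∀ (x y : ℕ → ℚ) →
  sumℕ k (λ r → x r * y (permℕ p r)) ≡ sumℕ k (λ s → sumℕ k (λ r → δ (permℕ p r) s * x r) * y s)
sumℕ-*-permℕ k p ord x y = begin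
  sumℕ k (λ r → x r * y (permℕ p r))
    ≡⟨ sumℕ-cong k (λ r r<k → cong (x r *_) (sym (sumℕ-δʳ k (permℕ p r) y (permℕ-< p ord r<k)))) ⟩
  sumℕ k (λ r → x r * sumℕ k (λ s → δ (permℕ p r) s * y s))
    ≡⟨ sumℕ-cong k (λ r _ → *-distribˡ-sumℕ k (x r) (λ s → δ (permℕ p r) s * y s)) ⟩
  sumℕ k (λ r → sumℕ k (λ s → x r * (δ (permℕ p r) s * y s)))
    ≡⟨ Σ-comm k k (λ m m′ → x (toℕ m) * (δ (permℕ p (toℕ m)) (toℕ m′) * y (toℕ m′))) ⟩
  sumℕ k (λ s → sumℕ k (λ r → x r * (δ (permℕ p r) s * y s)))
    ≡⟨ sumℕ-cong k (λ s _ → trans (sumℕ-cong k (λ r _ → solve 3 (λ x d y → x :* (d :* y) := (d :* x) :* y) refl (x r) (δ (permℕ p r) s) (y s)))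
                                  (sym (*-distribʳ-Σ k (y s) (λ m → δ (permℕ p (toℕ m)) s * x (toℕ m))))) ⟩
  sumℕ k (λ s → sumℕ k (λ r → δ (permℕ p r) s * x r) * y s) ∎
  where open ≡-Reasoning

Σ-sumℕ-*-permℕ : ∀ n S t k → (∀ i → order (S i) ≡ k) → ∀ (x y : ℕ → ℚ) →
  Σ[<] n (λ i → t i * sumℕ k (λ r → x r * y (permℕ (S i) r)))
    ≡ sumℕ k (λ s → sumℕ k (λ r → weightedPermMatrix n S t r s * x r) * y s)
Σ-sumℕ-*-permℕ n S t k ord x y = begin
  Σ[<] n (λ i → t i * sumℕ k (λ r → x r * y (permℕ (S i) r)))
    ≡⟨ Σ-cong n (λ i → cong (t i *_) (sumℕ-*-permℕ k (S i) (ord i) x y)) ⟩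
  Σ[<] n (λ i → t i * sumℕ k (λ s → sumℕ k (λ r → δ (permℕ (S i) r) s * x r) * y s))
    ≡⟨ Σ-*-sumℕ-comm k n t (λ i s → sumℕ k (λ r → δ (permℕ (S i) r) s * x r)) y ⟩
  sumℕ k (λ s → Σ[<] n (λ i → t i * sumℕ k (λ r → δ (permℕ (S i) r) s * x r)) * y s)
    ≡⟨ sumℕ-cong k (λ s _ → cong (_* y s) (Σ-*-sumℕ-comm k n t (λ i r → δ (permℕ (S i) r) s) x)) ⟩
  sumℕ k (λ s → sumℕ k (λ r → weightedPermMatrix n S t r s * x r) * y s) ∎
  where open ≡-Reasoning

sumℕ-δ-row : ∀ k r → r < k → sumℕ k (δ r) ≡ 1ℚ
sumℕ-δ-row k r r<k = trans (sumℕ-cong k (λ j _ → sym (*-identityʳ (δ r j)))) (sumℕ-δʳ k r (λ _ → 1ℚ) r<k)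

sumℕ-δ-column : ∀ k s → s < k → sumℕ k (λ r → δ r s) ≡ 1ℚ
sumℕ-δ-column k s s<k = trans (sumℕ-cong k (λ r _ → δ-sym r s)) (sumℕ-δ-row k s s<k)

Σ-*-1 : ∀ n (t : Fin n → ℚ) {u : Fin n → ℚ} → (∀ i → u i ≡ 1ℚ) → Σ[<] n (λ i → t i * u i) ≡ Σ[<] n t
Σ-*-1 n t u≡1 = Σ-cong n (λ i → trans (cong (t i *_) (u≡1 i)) (*-identityʳ (t i)))

weightedPermMatrix-row : ∀ n S t {k} → (∀ i → order (S i) ≡ k) →
  ∀ r → r < k → sumℕ k (weightedPermMatrix n S t r) ≡ Σ[<] n t
weightedPermMatrix-row n S t {k} ord r r<k =
  trans (sumℕ-Σ-comm k n t (λ i → δ (permℕ (S i) r)))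
        (Σ-*-1 n t (λ i → sumℕ-δ-row k (permℕ (S i) r) (permℕ-< (S i) (ord i) r<k)))

weightedPermMatrix-column : ∀ n S t {k} → (∀ i → order (S i) ≡ k) →
  ∀ s → s < k → sumℕ k (λ r → weightedPermMatrix n S t r s) ≡ Σ[<] n t
weightedPermMatrix-column n S t {k} ord s s<k =
  trans (sumℕ-Σ-comm k n t (λ i r → δ (permℕ (S i) r) s))
        (Σ-*-1 n t (λ i → trans (sumℕ-permℕ (S i) (λ j → δ j s) (ord i)) (sumℕ-δ-column k s s<k)))

x-y≡z-w⇒x+w≡y+z : ∀ x y z w → x - y ≡ z - w → x + w ≡ y + z
x-y≡z-w⇒x+w≡y+z x y z w eq = begin
  x + w              ≡⟨ solve 3 (λ x y w → x :+ w := y :+ ((x :- y) :+ w)) refl x y w ⟩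
  y + ((x - y) + w)  ≡⟨ cong (λ d → y + (d + w)) eq ⟩
  y + ((z - w) + w)  ≡⟨ solve 3 (λ y z w → y :+ ((z :- w) :+ w) := y :+ z) refl y z w ⟩
  y + z              ∎
  where open ≡-Reasoning

linRel⇒matrix-additive : ∀ n S t D → (∀ i → order (S i) ≡ suc (suc D)) → LinRel n S t →
  let X = weightedPermMatrix n S t in
  ∀ r s → r < suc (suc D) → s < suc (suc D) → X r s + X 0 0 ≡ X r 0 + X 0 s
linRel⇒matrix-additive n S t D ord rel r s r<k s<k =
  x-y≡z-w⇒x+w≡y+z (X r s) (X r 0) (X 0 s) (X 0 0) (factorPolys-independent D (λ r → X r s - X r 0) column-relation r r<k)
  where
  k = suc (suc D)
  X = weightedPermMatrix n S t
  A : ℕ → ℕ → ℚ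
  A N r = factorPoly D r (ℕ→ℚ N)
  h : ℕ → ℕ → ℚ
  h N s = sumℕ k (λ r → X r s * A N r)
  h-relation : ∀ N M → sumℕ k (λ s → h N s * A M s) ≡ 0ℚ
  h-relation N M = trans (sym (Σ-sumℕ-*-permℕ n S t k ord (A N) (A M))) (linRel-αN n S t D ord rel N M)
  column-relation : ∀ N → sumℕ k (λ r → (X r s - X r 0) * A N r) ≡ 0ℚ
  column-relation N = begin
    sumℕ k (λ r → (X r s - X r 0) * A N r)
      ≡⟨ sumℕ-cong k (λ r _ → solve 3 (λ a b c → (a :- b) :* c := a :* c :- b :* c) refl (X r s) (X r 0) (A N r)) ⟩
    sumℕ k (λ r → X r s * A N r - X r 0 * A N r)
      ≡⟨ sumℕ-distrib-- k (λ r → X r s * A N r) (λ r → X r 0 * A N r) ⟩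
    h N s - h N 0
      ≡⟨ cong (_- h N 0) (factorPolys-independent D (h N) (h-relation N) s s<k) ⟩
    h N 0 - h N 0
      ≡⟨ +-inverseʳ (h N 0) ⟩
    0ℚ ∎
    where open ≡-Reasoning

shifted-sums⇒shifts-equal : ∀ k (f g : ℕ → ℚ) a c → 0 < k →
  (∀ s → s < k → f s + c ≡ a + g s) → sumℕ k f ≡ sumℕ k g → c ≡ a
shifted-sums⇒shifts-equal k@(suc _) f g a c _ shifted Σf≡Σg = x-y≡0⇒x≡y c a (ℕ→ℚ-cancelˡ-≡0 k (begin
  K * (c - a)                        ≡⟨ solve 4 (λ K c a G → K :* (c :- a) := (G :+ K :* c) :- (K :* a :+ G)) refl K c a G ⟩
  (G + K * c) - (K * a + G)          ≡⟨ cong₂ (λ u v → (u + v) - (K * a + G)) (sym Σf≡Σg) (sym (sumℕ-const k c)) ⟩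
  (sumℕ k f + sumℕ k (λ _ → c)) - (K * a + G)
    ≡⟨ cong₂ (λ u v → u - (v + G)) (sym (sumℕ-distrib-+ k f (λ _ → c))) (sym (sumℕ-const k a)) ⟩
  sumℕ k (λ s → f s + c) - (sumℕ k (λ _ → a) + G)
    ≡⟨ cong₂ _-_ (sumℕ-cong k shifted) (sym (sumℕ-distrib-+ k (λ _ → a) g)) ⟩
  sumℕ k (λ s → a + g s) - sumℕ k (λ s → a + g s)
    ≡⟨ +-inverseʳ (sumℕ k (λ s → a + g s)) ⟩
  0ℚ                                 ∎))
  where
  open ≡-Reasoning
  K = ℕ→ℚ k
  G = sumℕ k g

additive⇒constant : ∀ k (X : ℕ → ℕ → ℚ) T →
  (∀ r s → r < k → s < k → X r s + X 0 0 ≡ X r 0 + X 0 s) →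
  (∀ r → r < k → sumℕ k (X r) ≡ T) → (∀ s → s < k → sumℕ k (λ r → X r s) ≡ T) →
  ∀ r s → r < k → s < k → X r s ≡ X 0 0
additive⇒constant k X T additive rows columns r s r<k s<k = begin
  X r s                         ≡⟨ solve 2 (λ x z → x := (x :+ z) :- z) refl (X r s) (X 0 0) ⟩
  (X r s + X 0 0) - X 0 0       ≡⟨ cong (_- X 0 0) (additive r s r<k s<k) ⟩
  (X r 0 + X 0 s) - X 0 0       ≡⟨ cong₂ (λ u v → (u + v) - X 0 0) (sym (first-column r r<k)) (sym (first-row s s<k)) ⟩
  (X 0 0 + X 0 0) - X 0 0       ≡⟨ solve 1 (λ z → (z :+ z) :- z := z) refl (X 0 0) ⟩
  X 0 0                         ∎
  where
  open ≡-Reasoning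
  0<k : 0 < k
  0<k = ℕP.≤-<-trans z≤n r<k
  first-column : ∀ r → r < k → X 0 0 ≡ X r 0
  first-column r r<k = shifted-sums⇒shifts-equal k (X r) (X 0) (X r 0) (X 0 0) 0<k
    (λ s s<k → additive r s r<k s<k) (trans (rows r r<k) (sym (rows 0 0<k)))
  first-row : ∀ s → s < k → X 0 0 ≡ X 0 s
  first-row s s<k = shifted-sums⇒shifts-equal k (λ r → X r s) (λ r → X r 0) (X 0 s) (X 0 0) 0<k
    (λ r r<k → trans (additive r s r<k s<k) (+-comm (X r 0) (X 0 s))) (trans (columns s s<k) (sym (columns 0 0<k)))

linRel⇒matrix-constant : ∀ n S t D → (∀ i → order (S i) ≡ suc (suc D)) → LinRel n S t →
  let X = weightedPermMatrix n S t in
  ∀ r s → r < suc (suc D) → s < suc (suc D) → X r s ≡ X 0 0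
linRel⇒matrix-constant n S t D ord rel = additive⇒constant (suc (suc D)) (weightedPermMatrix n S t) (Σ[<] n t)
  (linRel⇒matrix-additive n S t D ord rel) (weightedPermMatrix-row n S t ord) (weightedPermMatrix-column n S t ord)

avoiding-value : ∀ {n k} → n < k → (v : Fin n → ℕ) → ∃[ s ] s < k × (∀ i → v i ≢ s)
avoiding-value {n} {k} n<k v with FP.all? (λ (s : Fin k) → FP.any? (λ i → v i ℕP.≟ toℕ s))
... | no ¬all-hit = let (s , ¬hit) = FP.¬∀⟶∃¬ k _ (λ s → FP.any? (λ i → v i ℕP.≟ toℕ s)) ¬all-hit
                    in toℕ s , FP.toℕ<n s , (λ i vi≡s → ¬hit (i , vi≡s))
... | yes all-hit = ⊥-elim (ℕP.<-irrefl (trans (sym (proj₂ (all-hit s₁))) (trans (cong v f[s₁]≡f[s₂]) (proj₂ (all-hit s₂)))) s₁<s₂)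
  where
  f : Fin k → Fin n
  f s = proj₁ (all-hit s)
  pigeons = FP.pigeonhole n<k f
  s₁ = proj₁ pigeons
  s₂ = proj₁ (proj₂ pigeons)
  s₁<s₂ = proj₁ (proj₂ (proj₂ pigeons))
  f[s₁]≡f[s₂] = proj₂ (proj₂ (proj₂ pigeons))

*-δ-refl : ∀ t a → t * δ a a ≡ t
*-δ-refl t a = trans (cong (t *_) (δ-refl a)) (*-identityʳ t)

*-δ-≢ : ∀ t {a b} → a ≢ b → t * δ a b ≡ 0ℚ
*-δ-≢ t a≢b = trans (cong (t *_) (δ-≢ a≢b)) (*-zeroʳ t)

linRel⇒matrix-zero : ∀ n S t D → n < suc (suc D) → (∀ i → order (S i) ≡ suc (suc D)) → LinRel n S t →
  ∀ r s → r < suc (suc D) → s < suc (suc D) → weightedPermMatrix n S t r s ≡ 0ℚ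
linRel⇒matrix-zero n S t D n<k ord rel r s r<k s<k = begin
  X r s   ≡⟨ constant r s r<k s<k ⟩
  X 0 0   ≡⟨ sym (constant 0 s₀ z<s s₀<k) ⟩
  X 0 s₀  ≡⟨ Σ-zero n (λ i → *-δ-≢ (t i) (avoids i)) ⟩
  0ℚ      ∎
  where
  open ≡-Reasoning
  X = weightedPermMatrix n S t
  constant = linRel⇒matrix-constant n S t D ord rel
  avoid = avoiding-value n<k (λ i → permℕ (S i) 0)
  s₀ = proj₁ avoid
  s₀<k = proj₁ (proj₂ avoid)
  avoids = proj₂ (proj₂ avoid)

MatrixVanishes : ∀ n → (Fin n → Perm) → (Fin n → ℚ) → ℕ → Set
MatrixVanishes n S t k = ∀ r s → r < k → s < k → weightedPermMatrix n S t r s ≡ 0ℚ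

Distinct : ∀ {n} → (Fin n → Perm) → Set
Distinct S = ∀ i j → SamePerm (S i) (S j) → i ≡ j

distinct⇒differ : ∀ {n} (S : Fin n → Perm) {k} → Distinct S → (∀ i → order (S i) ≡ k) →
  ∀ i j → i ≢ j → ∃[ r ] r < k × permℕ (S i) r ≢ permℕ (S j) r
distinct⇒differ S distinct ord i j i≢j
  with r , r<k , differ ← different⇒differ-somewhere (S i) (S j) (trans (ord i) (sym (ord j))) (i≢j ∘ distinct i j) =
  r , subst (r <_) (ord i) r<k , differ

matrixVanishes⇒trivial-1 : ∀ S t {k} → (∀ i → order (S i) ≡ k) → 0 < k → MatrixVanishes 1 S t k → ∀ i → t i ≡ 0ℚ
matrixVanishes⇒trivial-1 S t ord 0<k vanish F.zero = begin
  t F.zero                               ≡⟨ sym (trans (+-identityʳ _) (*-δ-refl (t F.zero) p₀)) ⟩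
  weightedPermMatrix 1 S t 0 p₀          ≡⟨ vanish 0 p₀ 0<k (permℕ-< (S F.zero) (ord F.zero) 0<k) ⟩
  0ℚ                                     ∎
  where
  open ≡-Reasoning
  p₀ = permℕ (S F.zero) 0

matrixVanishes⇒trivial-2 : ∀ S t {k} → Distinct S → (∀ i → order (S i) ≡ k) → MatrixVanishes 2 S t k → ∀ i → t i ≡ 0ℚ
matrixVanishes⇒trivial-2 S t {k} distinct ord vanish = λ { F.zero → t₀≡0 ; (F.suc F.zero) → t₁≡0 }
  where
  differ = distinct⇒differ S distinct ord F.zero (F.suc F.zero) (λ ())
  r = proj₁ differ
  r<k = proj₁ (proj₂ differ)
  p : Fin 2 → ℕ
  p i = permℕ (S i) r
  p₀≢p₁ : p F.zero ≢ p (F.suc F.zero)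
  p₀≢p₁ = proj₂ (proj₂ differ)
  vanish-at : ∀ i → t F.zero * δ (p F.zero) (p i) + (t (F.suc F.zero) * δ (p (F.suc F.zero)) (p i) + 0ℚ) ≡ 0ℚ
  vanish-at i = vanish r (p i) r<k (permℕ-< (S i) (ord i) r<k)
  t₀≡0 : t F.zero ≡ 0ℚ
  t₀≡0 = trans (sym (trans (cong₂ (λ a b → a + (b + 0ℚ)) (*-δ-refl (t F.zero) (p F.zero)) (*-δ-≢ (t (F.suc F.zero)) (p₀≢p₁ ∘ sym)))
                           (solve 1 (λ a → a :+ (con 0ℚ :+ con 0ℚ) := a) refl (t F.zero))))
               (vanish-at F.zero)
  t₁≡0 : t (F.suc F.zero) ≡ 0ℚ
  t₁≡0 = trans (sym (trans (cong₂ (λ a b → a + (b + 0ℚ)) (*-δ-≢ (t F.zero) p₀≢p₁) (*-δ-refl (t (F.suc F.zero)) (p (F.suc F.zero))))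
                           (solve 1 (λ b → con 0ℚ :+ (b :+ con 0ℚ) := b) refl (t (F.suc F.zero)))))
               (vanish-at (F.suc F.zero))

three-vanishing⇒first-zero : ∀ k (ta tb tc : ℚ) (pa pb pc : ℕ → ℕ) →
  (∀ r s → r < k → s < k → ta * δ (pa r) s + tb * δ (pb r) s + tc * δ (pc r) s ≡ 0ℚ) →
  (∀ r → r < k → pa r < k) → (∀ r → r < k → pb r < k) →
  (∃[ r ] r < k × pa r ≢ pb r) → (∃[ r ] r < k × pa r ≢ pc r) → ta ≡ 0ℚ
three-vanishing⇒first-zero k ta tb tc pa pb pc vanish pa< pb< (r , r<k , pa≢pb) (r′ , r′<k , pa≢pc) =
  by-cases (pc r ℕP.≟ pa r)
  where
  first-survives : ∀ {x y z} → x ≡ ta → y ≡ 0ℚ → z ≡ 0ℚ → x + y + z ≡ 0ℚ → ta ≡ 0ℚ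
  first-survives refl refl refl ta+0+0≡0 = trans (sym (trans (+-identityʳ _) (+-identityʳ ta))) ta+0+0≡0
  by-cases : Dec (pc r ≡ pa r) → ta ≡ 0ℚ
  by-cases (no pc≢pa) = first-survives (*-δ-refl ta (pa r)) (*-δ-≢ tb (pa≢pb ∘ sym)) (*-δ-≢ tc pc≢pa)
    (vanish r (pa r) r<k (pa< r r<k))
  by-cases (yes pc≡pa) = first-survives (*-δ-refl ta (pa r′)) (trans (cong (_* δ (pb r′) (pa r′)) tb≡0) (*-zeroˡ (δ (pb r′) (pa r′))))
    (*-δ-≢ tc (pa≢pc ∘ sym)) (vanish r′ (pa r′) r′<k (pa< r′ r′<k))
    where
    tb≡0 : tb ≡ 0ℚ
    tb≡0 = trans (sym (trans (cong₂ _+_ (cong₂ _+_ (*-δ-≢ ta pa≢pb) (*-δ-refl tb (pb r))) (*-δ-≢ tc (λ pc≡pb → pa≢pb (trans (sym pc≡pa) pc≡pb))))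
                             (solve 1 (λ b → con 0ℚ :+ b :+ con 0ℚ := b) refl tb)))
                 (vanish r (pb r) r<k (pb< r r<k))

matrixVanishes⇒trivial-3 : ∀ S t {k} → Distinct S → (∀ i → order (S i) ≡ k) → MatrixVanishes 3 S t k → ∀ i → t i ≡ 0ℚ
matrixVanishes⇒trivial-3 S t {k} distinct ord vanish = λ where
    F.zero → first-zero 0F 1F 2F (λ ()) (λ ())
      (λ r s → solve 3 (λ a b c → a :+ b :+ c := a :+ (b :+ (c :+ con 0ℚ))) refl (term 0F r s) (term 1F r s) (term 2F r s))
    (F.suc F.zero) → first-zero 1F 0F 2F (λ ()) (λ ())
      (λ r s → solve 3 (λ a b c → b :+ a :+ c := a :+ (b :+ (c :+ con 0ℚ))) refl (term 0F r s) (term 1F r s) (term 2F r s))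
    (F.suc (F.suc F.zero)) → first-zero 2F 0F 1F (λ ()) (λ ())
      (λ r s → solve 3 (λ a b c → c :+ a :+ b := a :+ (b :+ (c :+ con 0ℚ))) refl (term 0F r s) (term 1F r s) (term 2F r s))
  where
  0F 1F 2F : Fin 3
  0F = F.zero
  1F = F.suc F.zero
  2F = F.suc (F.suc F.zero)
  term : Fin 3 → ℕ → ℕ → ℚ
  term i r s = t i * δ (permℕ (S i) r) s
  first-zero : ∀ a b c → a ≢ b → a ≢ c →
    (∀ r s → term a r s + term b r s + term c r s ≡ weightedPermMatrix 3 S t r s) → t a ≡ 0ℚ
  first-zero a b c a≢b a≢c rearranged = three-vanishing⇒first-zero k (t a) (t b) (t c) (permℕ (S a)) (permℕ (S b)) (permℕ (S c))
    (λ r s r<k s<k → trans (rearranged r s) (vanish r s r<k s<k)) (λ _ → permℕ-< (S a) (ord a)) (λ _ → permℕ-< (S b) (ord b))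
    (distinct⇒differ S distinct ord a b a≢b) (distinct⇒differ S distinct ord a c a≢c)

≢⇒≡1∸ : ∀ {a b} → a < 2 → b < 2 → a ≢ b → b ≡ 1 ∸ a
≢⇒≡1∸ {0} {0} _ _ a≢b = ⊥-elim (a≢b refl)
≢⇒≡1∸ {0} {1} _ _ _   = refl
≢⇒≡1∸ {1} {0} _ _ _   = refl
≢⇒≡1∸ {1} {1} _ _ a≢b = ⊥-elim (a≢b refl)
≢⇒≡1∸ {suc (suc _)} (s≤s (s≤s ()))
≢⇒≡1∸ {_} {suc (suc _)} _ (s≤s (s≤s ()))

permℕ-order-2 : ∀ p → order p ≡ 2 → permℕ p 1 ≡ 1 ∸ permℕ p 0
permℕ-order-2 p ord = ≢⇒≡1∸ (permℕ-< p ord (s≤s z≤n)) (permℕ-< p ord (s≤s (s≤s z≤n)))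
  (ℕP.0≢1+n ∘ permℕ-injective p ord (s≤s z≤n) (s≤s (s≤s z≤n)))

no-three-distinct-of-order-2 : ∀ (S : Fin 3 → Perm) → Distinct S → (∀ i → order (S i) ≡ 2) → ⊥
no-three-distinct-of-order-2 S distinct ord =
  ℕP.<-irrefl (cong toℕ (distinct i j (agree⇒samePerm (S i) (S j) (trans (ord i) (sym (ord j))) agree))) i<j
  where
  f : Fin 3 → Fin 2
  f i = F.fromℕ< (permℕ-< (S i) (ord i) (s≤s z≤n))
  pigeons = FP.pigeonhole (ℕP.n<1+n 2) f
  i = proj₁ pigeons
  j = proj₁ (proj₂ pigeons)
  i<j = proj₁ (proj₂ (proj₂ pigeons))
  agree₀ : permℕ (S i) 0 ≡ permℕ (S j) 0
  agree₀ = trans (sym (FP.toℕ-fromℕ< _)) (trans (cong toℕ (proj₂ (proj₂ (proj₂ pigeons)))) (FP.toℕ-fromℕ< _))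
  agree : ∀ r → r < order (S i) → permℕ (S i) r ≡ permℕ (S j) r
  agree 0 _ = agree₀
  agree 1 _ = trans (permℕ-order-2 (S i) (ord i)) (trans (cong (1 ∸_) agree₀) (sym (permℕ-order-2 (S j) (ord j))))
  agree (suc (suc r)) r<o with s≤s (s≤s ()) ← subst (suc (suc r) <_) (ord i) r<o

-- Relations between permutations of different orders

scaledGradPoly-polynomial : ∀ D p z → IsPolynomial (λ y → scaledGradPoly D p y z)
scaledGradPoly-polynomial D p z = coeffList (suc D) (λ s → bernsteinWeight D s * (h s - h (suc s))) , λ y →
  trans (sumℕ-cong (suc (suc D)) (λ r _ → *-comm (factorPoly D r y) (h r))) (Σ-*-factorPoly D h y)
  where
  h : ℕ → ℚ
  h r = factorPoly D (permℕ p r) z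

sumℕ-δ-permℕ : ∀ p {k} (g : ℕ → ℚ) → order p ≡ k → ∀ j → j < k → sumℕ k (λ r → δ (permℕ p r) (permℕ p j) * g r) ≡ g j
sumℕ-δ-permℕ p {k} g ord j j<k = trans (sumℕ-cong k pointwise) (sumℕ-δʳ k j g j<k)
  where
  pointwise : ∀ r → r < k → δ (permℕ p r) (permℕ p j) * g r ≡ δ j r * g r
  pointwise r r<k with r ℕP.≟ j
  ... | yes refl = cong (_* g r) (trans (δ-refl (permℕ p r)) (sym (δ-refl r)))
  ... | no r≢j = cong (_* g r) (trans (δ-≢ (r≢j ∘ permℕ-injective p ord r<k j<k)) (sym (δ-≢ (r≢j ∘ sym))))

permuted-factorPolys-independent : ∀ D p (g : ℕ → ℚ) → order p ≡ suc (suc D) →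
  (∀ M → sumℕ (suc (suc D)) (λ r → g r * factorPoly D (permℕ p r) (ℕ→ℚ M)) ≡ 0ℚ) →
  ∀ j → j < suc (suc D) → g j ≡ g 0
permuted-factorPolys-independent D p g ord vanish j j<k = begin
  g j          ≡⟨ sym (sumℕ-δ-permℕ p g ord j j<k) ⟩
  G (permℕ p j) ≡⟨ G-constant (permℕ p j) (permℕ-< p ord j<k) ⟩
  G 0          ≡⟨ sym (G-constant (permℕ p 0) (permℕ-< p ord z<s)) ⟩
  G (permℕ p 0) ≡⟨ sumℕ-δ-permℕ p g ord 0 z<s ⟩
  g 0          ∎
  where
  open ≡-Reasoning
  k = suc (suc D)
  G : ℕ → ℚ
  G s = sumℕ k (λ r → δ (permℕ p r) s * g r)
  G-constant : ∀ s → s < k → G s ≡ G 0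
  G-constant = factorPolys-independent D G (λ M → trans (sym (sumℕ-*-permℕ k p ord g (λ s → factorPoly D s (ℕ→ℚ M)))) (vanish M))

factorPoly-at-−1 : ∀ D → 1 ≤ D → factorPoly D 0 (- 1ℚ) ≢ factorPoly D 1 (- 1ℚ)
factorPoly-at-−1 D 1≤D A₀≡A₁ = positive⇒≢0 (w₀ + w₀ + w₁) (pos+pos⇒pos (w₀ + w₀) {{pos+pos⇒pos w₀ {{w₀>0}} w₀ {{w₀>0}}}} w₁ {{w₁>0}}) (begin
  w₀ + w₀ + w₁                              ≡⟨ solve 2 (λ a b → a :+ a :+ b := a :* con 1ℚ :- (b :* (:- con 1ℚ :* con 1ℚ) :- a :* con 1ℚ)) refl w₀ w₁ ⟩
  w₀ * 1ℚ - (w₁ * (- 1ℚ * 1ℚ) - w₀ * 1ℚ)    ≡⟨ cong₂ _-_ (sym A₀) (sym A₁) ⟩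
  factorPoly D 0 (- 1ℚ) - factorPoly D 1 (- 1ℚ) ≡⟨ cong (_- factorPoly D 1 (- 1ℚ)) A₀≡A₁ ⟩
  factorPoly D 1 (- 1ℚ) - factorPoly D 1 (- 1ℚ) ≡⟨ +-inverseʳ (factorPoly D 1 (- 1ℚ)) ⟩
  0ℚ                                        ∎)
  where
  open ≡-Reasoning
  w₀ = bernsteinWeight D 0
  w₁ = bernsteinWeight D 1
  w₀>0 = invFact-positive 0 D
  w₁>0 = invFact-positive 1 (D ∸ 1)
  positive⇒≢0 : ∀ x → Positive x → x ≢ 0ℚ
  positive⇒≢0 x x>0 x≡0 = <-irrefl (sym x≡0) (positive⁻¹ x {{x>0}})
  A₀ : factorPoly D 0 (- 1ℚ) ≡ w₀ * 1ℚ
  A₀ = trans (factorPoly-zero D (- 1ℚ)) (weightedMonomial-≤ D 0 (- 1ℚ) z≤n)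
  A₁ : factorPoly D 1 (- 1ℚ) ≡ w₁ * (- 1ℚ * 1ℚ) - w₀ * 1ℚ
  A₁ = trans (factorPoly-suc D 0 (- 1ℚ)) (cong₂ _-_ (weightedMonomial-≤ D 1 (- 1ℚ) 1≤D) (weightedMonomial-≤ D 0 (- 1ℚ) z≤n))

module DifferentOrders (pa pb : Perm) (Da E : ℕ) (ta tb : ℚ)
  (orda : order pa ≡ suc (suc Da)) (ordb : order pb ≡ suc (suc (Da ℕ.+ suc E)))
  (rel : ∀ α β → ta * gradPoly pa α β + tb * gradPoly pb α β ≡ 0ℚ) where

  Db = Da ℕ.+ suc E
  Ka = ℕ→ℚ (suc (suc Da) !)
  Kb = ℕ→ℚ (suc (suc Db) !)

  -- The relation at (N/(N+1), M/(M+1)), scaled by ((N+1)(M+1))^Db, as a polynomial in y = N;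
  -- the smaller-order term carries the factor (1 + y)^E.
  relationPoly : ℕ → ℚ → ℚ
  relationPoly M y = ta * Ka * cN M ^ℚ suc E * ((1ℚ + y) ^ℚ suc E * scaledGradPoly Da pa y (ℕ→ℚ M))
                     + tb * Kb * scaledGradPoly Db pb y (ℕ→ℚ M)

  relationPoly-polynomial : ∀ M → IsPolynomial (relationPoly M)
  relationPoly-polynomial M =
    isPolynomial-+ (isPolynomial-scale (ta * Ka * cN M ^ℚ suc E) (isPolynomial-*[1+X]^ (suc E) (scaledGradPoly-polynomial Da pa (ℕ→ℚ M))))
                   (isPolynomial-scale (tb * Kb) (scaledGradPoly-polynomial Db pb (ℕ→ℚ M)))

  relationPoly-vanishes-on-ℕ : ∀ M N → relationPoly M (ℕ→ℚ N) ≡ 0ℚ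
  relationPoly-vanishes-on-ℕ M N = begin
    ta * Ka * cM^E * ((1ℚ + ℕ→ℚ N) ^ℚ suc E * Za) + tb * Kb * Zb
      ≡⟨ cong (λ x → ta * Ka * cM^E * (x ^ℚ suc E * Za) + tb * Kb * Zb) (sym (ℕ→ℚ-+ 1 N)) ⟩
    ta * Ka * cM^E * (cN^E * Za) + tb * Kb * Zb
      ≡⟨ solve 8 (λ ta Ka cM cN za tb Kb zb → ta :* Ka :* cM :* (cN :* za) :+ tb :* Kb :* zb := ta :* (Ka :* za) :* (cN :* cM) :+ tb :* (Kb :* zb))
               refl ta Ka cM^E cN^E Za tb Kb Zb ⟩
    ta * (Ka * Za) * (cN^E * cM^E) + tb * (Kb * Zb)
      ≡⟨ cong₂ (λ u v → ta * u * (cN^E * cM^E) + tb * v) (sym (gradPoly-αN pa Da N M orda)) (sym (gradPoly-αN pb Db N M ordb)) ⟩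
    ta * (Pa * Ca) * (cN^E * cM^E) + tb * (Pb * Cb)
      ≡⟨ cong (λ c → ta * (Pa * Ca) * (cN^E * cM^E) + tb * (Pb * c)) Cb≡ ⟩
    ta * (Pa * Ca) * (cN^E * cM^E) + tb * (Pb * (Ca * (cN^E * cM^E)))
      ≡⟨ solve 6 (λ ta Pa Ca C tb Pb → ta :* (Pa :* Ca) :* C :+ tb :* (Pb :* (Ca :* C)) := (ta :* Pa :+ tb :* Pb) :* (Ca :* C))
               refl ta Pa Ca (cN^E * cM^E) tb Pb ⟩
    (ta * Pa + tb * Pb) * (Ca * (cN^E * cM^E))
      ≡⟨ cong (_* (Ca * (cN^E * cM^E))) (rel (αN N) (αN M)) ⟩
    0ℚ * (Ca * (cN^E * cM^E))
      ≡⟨ *-zeroˡ (Ca * (cN^E * cM^E)) ⟩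
    0ℚ ∎
    where
    open ≡-Reasoning
    Za = scaledGradPoly Da pa (ℕ→ℚ N) (ℕ→ℚ M)
    Zb = scaledGradPoly Db pb (ℕ→ℚ N) (ℕ→ℚ M)
    cN^E = cN N ^ℚ suc E
    cM^E = cN M ^ℚ suc E
    Pa = gradPoly pa (αN N) (αN M)
    Pb = gradPoly pb (αN N) (αN M)
    Ca = cN N ^ℚ Da * cN M ^ℚ Da
    Cb = cN N ^ℚ Db * cN M ^ℚ Db
    Cb≡ : Cb ≡ Ca * (cN^E * cM^E)
    Cb≡ = trans (cong₂ _*_ (^ℚ-distribˡ-+-* (cN N) Da (suc E)) (^ℚ-distribˡ-+-* (cN M) Da (suc E)))
      (solve 4 (λ a b c d → (a :* b) :* (c :* d) := (a :* c) :* (b :* d)) refl (cN N ^ℚ Da) cN^E (cN M ^ℚ Da) cM^E)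

  relationPoly-at-−1 : ∀ M → relationPoly M (- 1ℚ) ≡ tb * (Kb * scaledGradPoly Db pb (- 1ℚ) (ℕ→ℚ M))
  relationPoly-at-−1 M = begin
    a * ((1ℚ + - 1ℚ) ^ℚ suc E * Za) + tb * Kb * Zb
      ≡⟨ cong (λ x → a * (x ^ℚ suc E * Za) + tb * Kb * Zb) (+-inverseʳ 1ℚ) ⟩
    a * ((0ℚ * 0ℚ ^ℚ E) * Za) + tb * Kb * Zb
      ≡⟨ solve 6 (λ a p za tb Kb zb → a :* ((con 0ℚ :* p) :* za) :+ tb :* Kb :* zb := tb :* (Kb :* zb)) refl a (0ℚ ^ℚ E) Za tb Kb Zb ⟩
    tb * (Kb * Zb) ∎
    where
    open ≡-Reasoning
    a = ta * Ka * cN M ^ℚ suc E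
    Za = scaledGradPoly Da pa (- 1ℚ) (ℕ→ℚ M)
    Zb = scaledGradPoly Db pb (- 1ℚ) (ℕ→ℚ M)

  larger-order-root : tb ≢ 0ℚ → ∀ M → scaledGradPoly Db pb (- 1ℚ) (ℕ→ℚ M) ≡ 0ℚ
  larger-order-root tb≢0 M =
    ℕ→ℚ-cancelˡ-≡0 (suc (suc Db) !) {{suc (suc Db) !≢0}}
      (*-cancelˡ-≡0 {(1/ tb) {{≢-nonZero tb≢0}}} (*-inverseˡ tb {{≢-nonZero tb≢0}})
        (trans (sym (relationPoly-at-−1 M))
               (polynomial-vanishes-on-ℕ⇒≡0 (relationPoly-polynomial M) (relationPoly-vanishes-on-ℕ M) (- 1ℚ))))

smaller-order-relation⇒larger-trivial : ∀ pa pb ta tb {Da Db} → Da < Db →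
  order pa ≡ suc (suc Da) → order pb ≡ suc (suc Db) →
  (∀ α β → ta * gradPoly pa α β + tb * gradPoly pb α β ≡ 0ℚ) → tb ≡ 0ℚ
smaller-order-relation⇒larger-trivial pa pb ta tb {Da} {Db} Da<Db orda ordb rel =
  decidable-stable (tb ≟ 0ℚ) λ tb≢0 → factorPoly-at-−1 Db′ (ℕP.≤-trans (s≤s z≤n) (ℕP.m≤n+m (suc E) Da)) (sym
    (permuted-factorPolys-independent Db′ pb (λ r → factorPoly Db′ r (- 1ℚ)) ordb′
      (DifferentOrders.larger-order-root pa pb Da E ta tb orda ordb′ rel tb≢0) 1 (s<s (s<s z≤n))))
  where
  E = proj₁ (ℕP.m≤n⇒∃[o]m+o≡n Da<Db)
  Db′ = Da ℕ.+ suc E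
  ordb′ : order pb ≡ suc (suc Db′)
  ordb′ = trans ordb (cong (suc ∘ suc) (sym (trans (ℕP.+-suc Da E) (proj₂ (ℕP.m≤n⇒∃[o]m+o≡n Da<Db)))))

Trivial : ∀ {n} → (Fin n → ℚ) → Set
Trivial t = ∀ i → t i ≡ 0ℚ

same-order-linRel⇒trivial : ∀ n S t D → n ≤ 3 → n < suc (suc D) → Distinct S →
  (∀ i → order (S i) ≡ suc (suc D)) → LinRel n S t → Trivial t
same-order-linRel⇒trivial 0 S t D _ _ _ _ _ = λ ()
same-order-linRel⇒trivial 1 S t D _ n<k _ ord rel =
  matrixVanishes⇒trivial-1 S t ord z<s (linRel⇒matrix-zero 1 S t D n<k ord rel)
same-order-linRel⇒trivial 2 S t D _ n<k distinct ord rel =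
  matrixVanishes⇒trivial-2 S t distinct ord (linRel⇒matrix-zero 2 S t D n<k ord rel)
same-order-linRel⇒trivial 3 S t D _ n<k distinct ord rel =
  matrixVanishes⇒trivial-3 S t distinct ord (linRel⇒matrix-zero 3 S t D n<k ord rel)
same-order-linRel⇒trivial (suc (suc (suc (suc _)))) S t D (s≤s (s≤s (s≤s ())))

different-orders-relation⇒trivial : ∀ pa pb ta tb {Da Db} → Da < Db →
  order pa ≡ suc (suc Da) → order pb ≡ suc (suc Db) →
  (∀ α β → ta * gradPoly pa α β + tb * gradPoly pb α β ≡ 0ℚ) → ta ≡ 0ℚ × tb ≡ 0ℚ
different-orders-relation⇒trivial pa pb ta tb {Da} Da<Db orda ordb rel = ta≡0 , tb≡0
  where
  tb≡0 = smaller-order-relation⇒larger-trivial pa pb ta tb Da<Db orda ordb rel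
  single-relation : LinRel 1 (λ _ → pa) (λ _ → ta)
  single-relation α β = trans (cong (λ x → ta * gradPoly pa α β + x) (sym (*-zeroˡ (gradPoly pb α β))))
    (trans (cong (λ x → ta * gradPoly pa α β + x * gradPoly pb α β) (sym tb≡0)) (rel α β))
  ta≡0 = same-order-linRel⇒trivial 1 (λ _ → pa) (λ _ → ta) Da (s≤s z≤n) (s≤s (s≤s z≤n))
           (λ { F.zero F.zero _ → refl }) (λ _ → orda) single-relation F.zero

1<⇒2+ : ∀ {m} → 1 < m → ∃[ D ] m ≡ suc (suc D)
1<⇒2+ {suc (suc D)} _         = D , refl
1<⇒2+ {suc zero}    (s≤s ())

single-linRel⇒trivial : ∀ S t → (∀ i → 1 < order (S i)) → LinRel 1 S t → Trivial t
single-linRel⇒trivial S t 1<ord rel with D , ord₀ ← 1<⇒2+ (1<ord F.zero) =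
  same-order-linRel⇒trivial 1 S t D (s≤s z≤n) (s≤s (s≤s z≤n)) (λ { F.zero F.zero _ → refl }) (λ { F.zero → ord₀ }) rel

pair-linRel⇒orders-2 : ∀ S t → Distinct S → (∀ i → 1 < order (S i)) → LinRel 2 S t → ¬ Trivial t →
  ∀ i → order (S i) ≡ 2
pair-linRel⇒orders-2 S t distinct 1<ord rel nontrivial =
  by-orders (proj₂ (1<⇒2+ (1<ord 0F))) (proj₂ (1<⇒2+ (1<ord 1F))) (ℕP.<-cmp _ _)
  where
  0F 1F : Fin 2
  0F = F.zero
  1F = F.suc F.zero
  rel₀₁ : ∀ α β → t 0F * gradPoly (S 0F) α β + t 1F * gradPoly (S 1F) α β ≡ 0ℚ
  rel₀₁ α β = trans (cong (t 0F * gradPoly (S 0F) α β +_) (sym (+-identityʳ (t 1F * gradPoly (S 1F) α β)))) (rel α β)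
  rel₁₀ : ∀ α β → t 1F * gradPoly (S 1F) α β + t 0F * gradPoly (S 0F) α β ≡ 0ℚ
  rel₁₀ α β = trans (+-comm (t 1F * gradPoly (S 1F) α β) (t 0F * gradPoly (S 0F) α β)) (rel₀₁ α β)
  trivial : t 0F ≡ 0ℚ → t 1F ≡ 0ℚ → Trivial t
  trivial t₀≡0 t₁≡0 F.zero         = t₀≡0
  trivial t₀≡0 t₁≡0 (F.suc F.zero) = t₁≡0
  by-orders : ∀ {D₀ D₁} → order (S 0F) ≡ suc (suc D₀) → order (S 1F) ≡ suc (suc D₁) →
    Tri (D₀ < D₁) (D₀ ≡ D₁) (D₁ < D₀) → ∀ i → order (S i) ≡ 2
  by-orders ord₀ ord₁ (tri< D₀<D₁ _ _) = ⊥-elim (nontrivial (trivial (proj₁ t≡0) (proj₂ t≡0)))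
    where t≡0 = different-orders-relation⇒trivial (S 0F) (S 1F) (t 0F) (t 1F) D₀<D₁ ord₀ ord₁ rel₀₁
  by-orders ord₀ ord₁ (tri> _ _ D₁<D₀) = ⊥-elim (nontrivial (trivial (proj₂ t≡0) (proj₁ t≡0)))
    where t≡0 = different-orders-relation⇒trivial (S 1F) (S 0F) (t 1F) (t 0F) D₁<D₀ ord₁ ord₀ rel₁₀
  by-orders {zero} ord₀ ord₁ (tri≈ _ refl _) = λ where
    F.zero         → ord₀
    (F.suc F.zero) → ord₁
  by-orders {suc D} ord₀ ord₁ (tri≈ _ refl _) =
    ⊥-elim (nontrivial (same-order-linRel⇒trivial 2 S t (suc D) (s≤s (s≤s z≤n)) (s≤s (s≤s (s≤s z≤n))) distinct ord rel))
    where
    ord : ∀ i → order (S i) ≡ suc (suc (suc D))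
    ord F.zero         = ord₀
    ord (F.suc F.zero) = ord₁

triple-same-order-linRel⇒order-3 : ∀ S t → Distinct S → (∀ i → 1 < order (S i)) →
  (∀ i j → order (S i) ≡ order (S j)) → LinRel 3 S t → ¬ Trivial t → ∀ i → order (S i) ≡ 3
triple-same-order-linRel⇒order-3 S t distinct 1<ord same rel nontrivial =
  by-order D (λ i → trans (same i F.zero) ord₀)
  where
  D = proj₁ (1<⇒2+ (1<ord F.zero))
  ord₀ = proj₂ (1<⇒2+ (1<ord F.zero))
  by-order : ∀ D → (∀ i → order (S i) ≡ suc (suc D)) → ∀ i → order (S i) ≡ 3
  by-order 0 ord = ⊥-elim (no-three-distinct-of-order-2 S distinct ord)
  by-order 1 ord = ord
  by-order (suc (suc D)) ord = ⊥-elim (nontrivial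
    (same-order-linRel⇒trivial 3 S t (suc (suc D)) ℕP.≤-refl (s≤s (s≤s (s≤s (s≤s z≤n)))) distinct ord rel))

lemma11 : (n : ℕ) (S : Fin n → Perm)
    → (∀ i j → SamePerm (S i) (S j) → i ≡ j)
    → (∀ i → 1 < order (S i))
    → LinDep n S
    → (n ≢ 1)
      × (n ≡ 2 → ∀ i → order (S i) ≡ 2)
      × (n ≡ 3 → (∀ i j → order (S i) ≡ order (S j)) → ∀ i → order (S i) ≡ 3)
lemma11 n S distinct 1<ord (t , (i₀ , tᵢ₀≢0) , rel) = not-singleton , pair-orders , triple-orders
  where
  nontrivial : ¬ Trivial t
  nontrivial trivial = tᵢ₀≢0 (trivial i₀)
  not-singleton : n ≢ 1
  not-singleton refl = nontrivial (single-linRel⇒trivial S t 1<ord rel)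
  pair-orders : n ≡ 2 → ∀ i → order (S i) ≡ 2
  pair-orders refl = pair-linRel⇒orders-2 S t distinct 1<ord rel nontrivial
  triple-orders : n ≡ 3 → (∀ i j → order (S i) ≡ order (S j)) → ∀ i → order (S i) ≡ 3
  triple-orders refl same = triple-same-order-linRel⇒order-3 S t distinct 1<ord same rel nontrivial
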